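{- The following forward proof-search procedure FSearch is adequate: for every formula $G$, FSearch$(G)$ terminates and returns either an $\mathbf{FRJ}(G)$-derivation of $G$ or a saturated database for $G$. Procedure: maintain a set $DB$ (initially empty), a set $I$ (initially the set of all axiom sequents of $\mathbf{FRJ}(G)$) and a set of derivations (initially the axioms). While $I\neq\emptyset$ and $DB$ contains no regular sequent of the form $\Gamma\Rightarrow G$: set $DB:=DB\cup I$ and $I:=\emptyset$; for every instance of a rule of $\mathbf{FRJ}(G)$ all of whose premises belong to $DB$, with conclusion $\sigma$, if $DB$ contains no $\sigma'$ with $\sigma\sqsubseteq\sigma'$, then add $\sigma$ to $I$ and record the derivation of $\sigma$ obtained by applying the rule to the recorded derivations of its premises. At the end, if $DB$ contains some $\Gamma\Rightarrow G$ return its recorded derivation, otherwise return $DB$.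
   Context: Formulas are built from a countably infinite set $\mathcal{V}$ of propositional variables and $\bot$ using $\land,\lor,\supset$. Let $\mathcal{V}_\bot=\mathcal{V}\cup\{\bot\}$, $\mathcal{L}^{\supset}$ the set of formulas with main connective $\supset$. For a formula $G$, $\mathrm{Sl}(G)$ and $\mathrm{Sr}(G)$ are the smallest subsets of the subformulas of $G$ with: $G\in\mathrm{Sr}(G)$; $A\land B$ or $A\lor B$ in $\mathrm{Sl}(G)$ (resp. $\mathrm{Sr}(G)$) implies $A,B$ in $\mathrm{Sl}(G)$ (resp. $\mathrm{Sr}(G)$); $A\supset B\in\mathrm{Sl}(G)$ implies $B\in\mathrm{Sl}(G)$, $A\in\mathrm{Sr}(G)$; $A\supset B\in\mathrm{Sr}(G)$ implies $B\in\mathrm{Sr}(G)$, $A\in\mathrm{Sl}(G)$. $\mathrm{Cl}(\Gamma)$ is the smallest set containing $\Gamma$ such that if $X,Y\in\mathrm{Cl}(\Gamma)$ and $A$ is any formula then $X\land Y,A\lor X,X\lor A,A\supset X\in\mathrm{Cl}(\Gamma)$. $\mathbf{FRJ}(G)$: let $\bar\Gamma^{At}=\mathrm{Sl}(G)\cap\mathcal V$, $\bar\Gamma^{\supset}=\mathrm{Sl}(G)\cap\mathcal L^{\supset}$, $\bar\Gamma=\bar\Gamma^{At}\cup\bar\Gamma^{\supset}$. Sequents: regular $\Gamma\Rightarrow C$ ($\Gamma\subseteq\bar\Gamma$, $C\in\mathrm{Sr}(G)$), irregular $\Sigma;\Theta\rightarrow C$ ($\Sigma\cup\Theta\subseteq\bar\Gamma$,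 $C\in\mathrm{Sr}(G)$); conclusions always have right formula in $\mathrm{Sr}(G)$. Rules ($F\in\mathcal V_\bot$, $k\in\{1,2\}$): axioms $\bar\Gamma^{At}\setminus\{F\}\Rightarrow F$ and $\emptyset;(\bar\Gamma^{At}\setminus\{F\})\cup\bar\Gamma^{\supset}\rightarrow F$; ($\land$) $\Gamma\Rightarrow A_k/\Gamma\Rightarrow A_1\land A_2$ and $\Sigma;\Theta\rightarrow A_k/\Sigma;\Theta\rightarrow A_1\land A_2$; ($\lor$) $\Sigma_1;\Theta_1\rightarrow C_1$, $\Sigma_2;\Theta_2\rightarrow C_2 / \Sigma_1\cup\Sigma_2;\Theta_1\cap\Theta_2\rightarrow C_1\lor C_2$ if $\Sigma_1\subseteq\Sigma_2\cup\Theta_2$, $\Sigma_2\subseteq\Sigma_1\cup\Theta_1$; ($\supset_\in$) $\Gamma\Rightarrow B/\Gamma\Rightarrow A\supset B$ if $A\in\mathrm{Cl}(\Gamma)$, and $\Sigma;\Theta\cup\Lambda\rightarrow B/\Sigma\cup\Lambda;\Theta\rightarrow A\supset B$ if $\Theta\cap\Lambda=\emptyset$, $A\in\mathrm{Cl}(\Sigma\cup\Lambda)$ and no $\Lambda'\subsetneq\Lambda$ has $A\in\mathrm{Cl}(\Sigma\cup\Lambda')$; ($\supset_{\notin}$) $\Gamma\Rightarrow B/\emptyset;\Theta\rightarrow A\supset B$ if $\Theta\subseteq\mathrm{Cl}(\Gamma)\cap\bar\Gamma$, $A\in\mathrm{Cl}(\Gamma)\setminus\mathrm{Cl}(\Theta)$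 and every $\Theta'$ with $\Theta\subsetneq\Theta'\subseteq\mathrm{Cl}(\Gamma)\cap\bar\Gamma$ has $A\in\mathrm{Cl}(\Theta')$; join rules with premises $\Sigma_j;\Theta_j\rightarrow A_j$ ($1\le j\le n$, $n\ge1$): let $\Upsilon=\{A_1,\dots,A_n\}$, $\Sigma^{At}=\bigcup_j(\Sigma_j\cap\mathcal V)$, $\Sigma^{\supset}=\bigcup_j(\Sigma_j\cap\mathcal L^{\supset})$, $\Theta^{At}=\bigcap_j(\Theta_j\cap\mathcal V)$, $\Theta^{\supset}=\{Y\supset Z\in\bigcap_j(\Theta_j\cap\mathcal L^{\supset}):Y\in\Upsilon\}$, requiring $\Sigma_i\subseteq\Sigma_j\cup\Theta_j$ ($i\ne j$) and ($Y\supset Z\in\Sigma^{\supset}\Rightarrow Y\in\Upsilon$); ($\bowtie^{At}$) conclusion $\Sigma^{At}\cup(\Theta^{At}\setminus\{F\})\cup\Sigma^{\supset}\cup\Theta^{\supset}\Rightarrow F$, $F\in\mathcal V_\bot\setminus\Sigma^{At}$, where each $Y\in\Upsilon$ has some $Y\supset Z\in\mathrm{Sl}(G)$; ($\bowtie^{\lor}$) conclusion $\Sigma^{At}\cup\Theta^{At}\cup\Sigma^{\supset}\cup\Theta^{\supset}\Rightarrow C_1\lor C_2$, $\{C_1,C_2\}\subseteq\Upsilon$, where each $Y\in\Upsilon$ has some $Y\supset Z\in\mathrm{Sl}(G)$ or $Y\lor Z\in\mathrm{Sr}(G)$ or $Z\lor Y\in\mathrm{Sr}(G)$. An $\mathbf{FRJ}(G)$-derivation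 of $G$ is a derivation of some regular sequent $\Gamma\Rightarrow G$. Subsumption: $\sigma_1\sqsubseteq\sigma_2$ iff either $\sigma_1=\Gamma_1\Rightarrow C$, $\sigma_2=\Gamma_2\Rightarrow C$ with $\Gamma_1\subseteq\Gamma_2$, or $\sigma_1=\Sigma;\Theta_1\rightarrow C$, $\sigma_2=\Sigma;\Theta_2\rightarrow C$ (same $\Sigma$, same $C$) with $\Theta_1\subseteq\Theta_2$. A database for $G$ is a set of $\mathbf{FRJ}(G)$-sequents each derivable in $\mathbf{FRJ}(G)$; it is saturated if for every derivable $\mathbf{FRJ}(G)$-sequent $\sigma$ it contains some $\sigma'$ with $\sigma\sqsubseteq\sigma'$. -}

module Defs where

open import Data.Nat using (ℕ; zero; suc; _<_)
open import Data.List using (List; []; _∷_; _++_; length; lookup; map)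
open import Data.List.Membership.Propositional using (_∈_; _∉_)
open import Data.List.Relation.Binary.Subset.Propositional using (_⊆_)
open import Data.List.Relation.Unary.All using (All)
open import Data.List.Relation.Unary.Any using (Any)
open import Data.Fin using (Fin)
open import Data.Product using (Σ; Σ-syntax; _×_; _,_; proj₁; proj₂)
open import Data.Sum using (_⊎_)
open import Data.Empty using (⊥)
open import Relation.Nullary using (¬_)
open import Relation.Binary.PropositionalEquality using (_≡_; _≢_)

infixr 6 _⋀_
infixr 5 _⋁_
infixr 4 _⊃_

data Fm : Set where
  var    : ℕ → Fm
  falsum : Fm
  _⋀_    : Fm → Fm → Fm
  _⋁_    : Fm → Fm → Fm
  _⊃_    : Fm → Fm → Fm

data IsVar : Fm → Set where
  isVar : ∀ n → IsVar (var n)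

data IsImp : Fm → Set where
  isImp : ∀ A B → IsImp (A ⊃ B)

VBot : Fm → Set
VBot F = IsVar F ⊎ F ≡ falsum

mutual
  data Sl (G : Fm) : Fm → Set where
    sl-∧₁ : ∀ {A B} → Sl G (A ⋀ B) → Sl G A
    sl-∧₂ : ∀ {A B} → Sl G (A ⋀ B) → Sl G B
    sl-∨₁ : ∀ {A B} → Sl G (A ⋁ B) → Sl G A
    sl-∨₂ : ∀ {A B} → Sl G (A ⋁ B) → Sl G B
    sl-⊃  : ∀ {A B} → Sl G (A ⊃ B) → Sl G B
    sr-⊃l : ∀ {A B} → Sr G (A ⊃ B) → Sl G A

  data Sr (G : Fm) : Fm → Set where
    sr-top : Sr G G
    sr-∧₁  : ∀ {A B} → Sr G (A ⋀ B) → Sr G A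
    sr-∧₂  : ∀ {A B} → Sr G (A ⋀ B) → Sr G B
    sr-∨₁  : ∀ {A B} → Sr G (A ⋁ B) → Sr G A
    sr-∨₂  : ∀ {A B} → Sr G (A ⋁ B) → Sr G B
    sr-⊃   : ∀ {A B} → Sr G (A ⊃ B) → Sr G B
    sl-⊃l  : ∀ {A B} → Sl G (A ⊃ B) → Sr G A

data Cl (Γ : List Fm) : Fm → Set where
  cl-base : ∀ {X} → X ∈ Γ → Cl Γ X
  cl-∧    : ∀ {X Y} → Cl Γ X → Cl Γ Y → Cl Γ (X ⋀ Y)
  cl-∨l   : ∀ {X} A → Cl Γ X → Cl Γ (A ⋁ X)
  cl-∨r   : ∀ {X} A → Cl Γ X → Cl Γ (X ⋁ A)
  cl-⊃    : ∀ {X} A → Cl Γ X → Cl Γ (A ⊃ X)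

-- Finite sets of formulas are represented by lists (read as sets).

_≈ₚ_ : List Fm → (Fm → Set) → Set
L ≈ₚ P = ∀ x → (x ∈ L → P x) × (P x → x ∈ L)

_≐_ : List Fm → List Fm → Set
L ≐ M = (L ⊆ M) × (M ⊆ L)

_⊂_ : List Fm → List Fm → Set
L ⊂ M = (L ⊆ M) × ¬ (M ⊆ L)

ΓAt : Fm → Fm → Set
ΓAt G x = Sl G x × IsVar x

ΓImp : Fm → Fm → Set
ΓImp G x = Sl G x × IsImp x

Γbar : Fm → Fm → Set
Γbar G x = ΓAt G x ⊎ ΓImp G x

data Seq : Set where
  reg : List Fm → Fm → Seq
  irr : List Fm → List Fm → Fm → Seq

WF : Fm → Seq → Set
WF G (reg Γ C)   = (∀ x → x ∈ Γ → Γbar G x) × Sr G C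
WF G (irr Σ Θ C) = (∀ x → x ∈ Σ → Γbar G x) × (∀ x → x ∈ Θ → Γbar G x) × Sr G C

Prem : Set
Prem = List Fm × List Fm × Fm

pΣ : Prem → List Fm
pΣ = proj₁

pΘ : Prem → List Fm
pΘ j = proj₁ (proj₂ j)

pA : Prem → Fm
pA j = proj₂ (proj₂ j)

toIrr : Prem → Seq
toIrr j = irr (pΣ j) (pΘ j) (pA j)

module Join (G : Fm) (js : List Prem) where
  Υ : Fm → Set
  Υ x = Any (λ j → pA j ≡ x) js

  ΣAt : Fm → Set
  ΣAt x = IsVar x × Any (λ j → x ∈ pΣ j) js

  ΣImp : Fm → Set
  ΣImp x = IsImp x × Any (λ j → x ∈ pΣ j) js

  ΘAt : Fm → Set
  ΘAt x = IsVar x × All (λ j → x ∈ pΘ j) js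

  ΘImp : Fm → Set
  ΘImp x = (Σ[ Y ∈ Fm ] Σ[ Z ∈ Fm ] (x ≡ (Y ⊃ Z) × Υ Y)) × All (λ j → x ∈ pΘ j) js

  Cond : Set
  Cond = (0 < length js)
       × (∀ (i j : Fin (length js)) → i ≢ j →
            pΣ (lookup js i) ⊆ (pΣ (lookup js j) ++ pΘ (lookup js j)))
       × (∀ Y Z → ΣImp (Y ⊃ Z) → Υ Y)

-- Rule instances of FRJ(G): Rule G premises conclusion.
-- Conclusions are specified up to set equality of the list components.

data Rule (G : Fm) : List Seq → Seq → Set where
  ax-reg : ∀ {Γ F} → VBot F →
           Γ ≈ₚ (λ x → ΓAt G x × x ≢ F) →
           Rule G [] (reg Γ F)
  ax-irr : ∀ {Θ F} → VBot F →
           Θ ≈ₚ (λ x → (ΓAt G x × x ≢ F) ⊎ ΓImp G x) →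
           Rule G [] (irr [] Θ F)
  ∧-reg  : ∀ {Γ Γ' A₁ A₂ Ak} → (Ak ≡ A₁ ⊎ Ak ≡ A₂) → Γ' ≐ Γ →
           Rule G (reg Γ Ak ∷ []) (reg Γ' (A₁ ⋀ A₂))
  ∧-irr  : ∀ {Σ Σ' Θ Θ' A₁ A₂ Ak} → (Ak ≡ A₁ ⊎ Ak ≡ A₂) → Σ' ≐ Σ → Θ' ≐ Θ →
           Rule G (irr Σ Θ Ak ∷ []) (irr Σ' Θ' (A₁ ⋀ A₂))
  ∨-irr  : ∀ {Σ₁ Θ₁ C₁ Σ₂ Θ₂ C₂ Σ Θ} →
           Σ ≈ₚ (λ x → x ∈ Σ₁ ⊎ x ∈ Σ₂) →
           Θ ≈ₚ (λ x → x ∈ Θ₁ × x ∈ Θ₂) →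
           Σ₁ ⊆ (Σ₂ ++ Θ₂) → Σ₂ ⊆ (Σ₁ ++ Θ₁) →
           Rule G (irr Σ₁ Θ₁ C₁ ∷ irr Σ₂ Θ₂ C₂ ∷ []) (irr Σ Θ (C₁ ⋁ C₂))
  ⊃∈-reg : ∀ {Γ Γ' A B} → Γ' ≐ Γ → Cl Γ A →
           Rule G (reg Γ B ∷ []) (reg Γ' (A ⊃ B))
  ⊃∈-irr : ∀ {Σ Θp Σc Θc A B} (Λ : List Fm) →
           Θp ≐ (Θc ++ Λ) → Σc ≐ (Σ ++ Λ) →
           (∀ x → x ∈ Θc → x ∉ Λ) →
           Cl (Σ ++ Λ) A →
           (∀ Λ' → Λ' ⊂ Λ → ¬ Cl (Σ ++ Λ') A) →
           Rule G (irr Σ Θp B ∷ []) (irr Σc Θc (A ⊃ B))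
  ⊃∉     : ∀ {Γ Θ A B} →
           (∀ x → x ∈ Θ → Cl Γ x × Γbar G x) →
           Cl Γ A → ¬ Cl Θ A →
           (∀ Θ' → Θ ⊂ Θ' → (∀ x → x ∈ Θ' → Cl Γ x × Γbar G x) → Cl Θ' A) →
           Rule G (reg Γ B ∷ []) (irr [] Θ (A ⊃ B))
  ⋈At    : ∀ {js Γ F} → Join.Cond G js →
           Γ ≈ₚ (λ x → Join.ΣAt G js x ⊎ (Join.ΘAt G js x × x ≢ F)
                       ⊎ Join.ΣImp G js x ⊎ Join.ΘImp G js x) →
           VBot F → ¬ Join.ΣAt G js F →
           (∀ Y → Join.Υ G js Y → Σ[ Z ∈ Fm ] Sl G (Y ⊃ Z)) →
           Rule G (map toIrr js) (reg Γ F)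
  ⋈∨     : ∀ {js Γ C₁ C₂} → Join.Cond G js →
           Γ ≈ₚ (λ x → Join.ΣAt G js x ⊎ Join.ΘAt G js x
                       ⊎ Join.ΣImp G js x ⊎ Join.ΘImp G js x) →
           Join.Υ G js C₁ → Join.Υ G js C₂ →
           (∀ Y → Join.Υ G js Y →
              (Σ[ Z ∈ Fm ] Sl G (Y ⊃ Z)) ⊎ (Σ[ Z ∈ Fm ] Sr G (Y ⋁ Z))
                ⊎ (Σ[ Z ∈ Fm ] Sr G (Z ⋁ Y))) →
           Rule G (map toIrr js) (reg Γ (C₁ ⋁ C₂))

Step : Fm → List Seq → Seq → Set
Step G ps σ = WF G σ × Rule G ps σ

data Deriv (G : Fm) : Seq → Set where
  by : ∀ {ps σ} → Step G ps σ → All (Deriv G) ps → Deriv G σ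

_⊑_ : Seq → Seq → Set
reg Γ₁ C₁   ⊑ reg Γ₂ C₂   = C₁ ≡ C₂ × Γ₁ ⊆ Γ₂
irr Σ₁ Θ₁ C₁ ⊑ irr Σ₂ Θ₂ C₂ = Σ₁ ≐ Σ₂ × C₁ ≡ C₂ × Θ₁ ⊆ Θ₂
_ ⊑ _ = ⊥

Database : Fm → (Seq → Set) → Set
Database G D = ∀ σ → D σ → WF G σ × Deriv G σ

Saturated : Fm → (Seq → Set) → Set
Saturated G D = ∀ σ → Deriv G σ → Σ[ σ' ∈ Seq ] (D σ' × σ ⊑ σ')

-- The procedure FSearch: DB n and I n are the values of DB and I at the
-- start of the n-th test of the while-condition.

mutual
  DB : Fm → ℕ → Seq → Set
  DB G zero    σ = ⊥
  DB G (suc n) σ = DB G n σ ⊎ I G n σ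

  I : Fm → ℕ → Seq → Set
  I G zero    σ = Step G [] σ
  I G (suc n) σ = Σ[ ps ∈ List Seq ]
                    (Step G ps σ × All (DB G (suc n)) ps
                     × ¬ (Σ[ σ' ∈ Seq ] (DB G (suc n) σ' × σ ⊑ σ')))

Stop : Fm → ℕ → Set
Stop G n = (∀ σ → ¬ I G n σ) ⊎ (Σ[ Γ ∈ List Fm ] DB G n (reg Γ G))

-- Everything FSearch(G) can produce is built from the subformulas of G, so up to set
-- equality of their components there are only finitely many sequents (the canonical ones).
-- The rules of FRJ(G) are monotone for subsumption: if each premise of an instance is
-- subsumed by a sequent of a finite list L, then its conclusion is subsumed by the
-- conclusion of an instance with premises in L (for ⊃∉ and ⊃∈ on irregular sequents the
-- sets Θ and Λ are re-chosen inside the larger premise). Such instances form a finite,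
-- computable list, so every round of the loop is computable. A round that does not stop
-- adds a sequent subsumed by nothing in DB, and therefore strictly increases the number of
-- canonical sequents subsumed by DB, which is bounded: the loop stops. If it stops without
-- a goal sequent, no instance over DB yields anything new, and induction on derivations
-- shows that DB subsumes every derivable sequent.

module Submission where

open import Defs
open import Data.Bool using (Bool; true; false; not)
import Data.Bool.Properties as Bool
open import Data.Empty using (⊥; ⊥-elim)
open import Data.Fin using (Fin)
import Data.Fin.Properties as Fin
open import Data.List
  using (List; []; _∷_; _++_; length; lookup; map; filter; concatMap; cartesianProductWith; cartesianProduct)
open import Data.List.Membership.Propositional using (_∈_; _∉_; find; lose)
open import Data.List.Membership.Propositional.Properties
open import Data.List.Relation.Binary.Subset.Propositional using (_⊆_)
open import Data.List.Relation.Binary.Subset.Propositional.Properties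
  using (⊆-refl; ⊆-trans; Any-resp-⊆; xs⊆xs++ys)
  renaming (++⁺ to ++-⊆; ++⁺ʳ to ++⁺ʳ-⊆; ++⁺ˡ to ++⁺ˡ-⊆)
open import Data.List.Relation.Unary.All as All using (All; []; _∷_)
import Data.List.Relation.Unary.All.Properties as All
open import Data.List.Relation.Unary.Any as Any using (Any; here; there)
open import Data.List.Relation.Unary.Any.Properties using (++⁺ˡ; ++⁺ʳ; map⁺; concat⁺; lookup-index; ¬Any[])
open import Data.Nat using (ℕ; zero; suc; _+_; _<_; _≤_; z≤n; s≤s)
import Data.Nat as ℕ
import Data.Nat.Properties as ℕ
open import Data.Product using (Σ; Σ-syntax; ∃; _×_; _,_; proj₁; proj₂)
import Data.Product as Product
open import Data.Product.Properties using () renaming (≡-dec to ×-≡-dec)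
open import Data.Sum using (_⊎_; inj₁; inj₂; [_,_]′)
import Data.Sum as Sum
open import Function using (_∘_; const; id)
open import Relation.Binary.Definitions using (DecidableEquality)
open import Relation.Binary.PropositionalEquality using (_≡_; _≢_; refl; sym; trans; cong; subst; subst₂)
import Relation.Binary.PropositionalEquality as PropEq
open import Relation.Nullary using (¬_; Dec; yes; no; does)
open import Relation.Nullary.Decidable using (map′; _×-dec_; _⊎-dec_; ¬?)

module _ {A : Set} where

  sublists : List A → List (List A)
  sublists [] = [] ∷ []
  sublists (x ∷ xs) = map (x ∷_) (sublists xs) ++ sublists xs

  filter∈sublists : ∀ {P : A → Set} (P? : ∀ x → Dec (P x)) xs → filter P? xs ∈ sublists xs
  filter∈sublists P? [] = here refl
  filter∈sublists P? (x ∷ xs) with does (P? x)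
  ... | true = ∈-++⁺ˡ (∈-map⁺ (x ∷_) (filter∈sublists P? xs))
  ... | false = ∈-++⁺ʳ (map (x ∷_) (sublists xs)) (filter∈sublists P? xs)

  ∈-sublists⇒⊆ : ∀ xs {ys} → ys ∈ sublists xs → ys ⊆ xs
  ∈-sublists⇒⊆ [] (here refl) ()
  ∈-sublists⇒⊆ (x ∷ xs) m with ∈-++⁻ (map (x ∷_) (sublists xs)) m
  ... | inj₂ m′ = λ y → there (∈-sublists⇒⊆ xs m′ y)
  ... | inj₁ m′ with ∈-map⁻ (x ∷_) m′
  ... | zs , m″ , refl = λ { (here refl) → here refl ; (there y) → there (∈-sublists⇒⊆ xs m″ y) }

  ⊈⇒∃∉ : DecidableEquality A → ∀ {xs ys : List A} → ¬ xs ⊆ ys → Σ[ x ∈ A ] (x ∈ xs × x ∉ ys)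
  ⊈⇒∃∉ _≟_ {xs} {ys} xs⊈ys with Any.any? (λ x → ¬? (Any.any? (x ≟_) ys)) xs
  ... | yes a = find a
  ... | no ¬a = ⊥-elim (xs⊈ys λ {x} x∈ → decide x x∈)
    where
      decide : ∀ x → x ∈ xs → x ∈ ys
      decide x x∈ with Any.any? (x ≟_) ys
      ... | yes x∈ys = x∈ys
      ... | no x∉ys = ⊥-elim (¬a (lose x∈ x∉ys))

  count : ∀ {P : A → Set} → (∀ x → Dec (P x)) → List A → ℕ
  count P? [] = 0
  count P? (x ∷ xs) with does (P? x)
  ... | true = suc (count P? xs)
  ... | false = count P? xs

  module _ {P Q : A → Set} (P? : ∀ x → Dec (P x)) (Q? : ∀ x → Dec (Q x)) (P⇒Q : ∀ {x} → P x → Q x) where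

    count-mono : ∀ xs → count P? xs ≤ count Q? xs
    count-mono [] = z≤n
    count-mono (x ∷ xs) with P? x | Q? x
    ... | yes _ | yes _ = s≤s (count-mono xs)
    ... | yes p | no ¬q = ⊥-elim (¬q (P⇒Q p))
    ... | no _ | yes _ = ℕ.m≤n⇒m≤1+n (count-mono xs)
    ... | no _ | no _ = count-mono xs

    count-mono-< : ∀ {x} xs → x ∈ xs → Q x → ¬ P x → suc (count P? xs) ≤ count Q? xs
    count-mono-< (y ∷ xs) (here refl) q ¬p with P? y | Q? y
    ... | yes p | _ = ⊥-elim (¬p p)
    ... | no _ | yes _ = s≤s (count-mono xs)
    ... | no _ | no ¬q = ⊥-elim (¬q q)
    count-mono-< (y ∷ xs) (there x∈) q ¬p with P? y | Q? y
    ... | yes _ | yes _ = s≤s (count-mono-< xs x∈ q ¬p)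
    ... | yes p | no ¬q = ⊥-elim (¬q (P⇒Q p))
    ... | no _ | yes _ = ℕ.m≤n⇒m≤1+n (count-mono-< xs x∈ q ¬p)
    ... | no _ | no _ = count-mono-< xs x∈ q ¬p

  count≤length : ∀ {P : A → Set} (P? : ∀ x → Dec (P x)) xs → count P? xs ≤ length xs
  count≤length P? [] = z≤n
  count≤length P? (x ∷ xs) with does (P? x)
  ... | true = s≤s (count≤length P? xs)
  ... | false = ℕ.m≤n⇒m≤1+n (count≤length P? xs)

  Any-toList⁺ : ∀ {P Q : A → Set} {xs} (qs : All Q xs) → Any P xs → Any (P ∘ proj₁) (All.toList qs)
  Any-toList⁺ (_ ∷ _) (here p) = here p
  Any-toList⁺ (_ ∷ qs) (there p) = there (Any-toList⁺ qs p)

  nonempty⇒∃∈ : ∀ {xs : List A} → 0 < length xs → ∃ (_∈ xs)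
  nonempty⇒∃∈ {x ∷ _} _ = x , here refl

  Any-concatMap⁺ : ∀ {B : Set} {P : B → Set} (f : A → List B) {x xs} →
                   x ∈ xs → Any P (f x) → Any P (concatMap f xs)
  Any-concatMap⁺ f x∈ p = concat⁺ (map⁺ (lose x∈ p))

infix 4 _≟_

_≟_ : DecidableEquality Fm
var n ≟ var m with n ℕ.≟ m
... | yes refl = yes refl
... | no n≢m = no λ { refl → n≢m refl }
falsum ≟ falsum = yes refl
(A ⋀ B) ≟ (C ⋀ D) = map′ (λ { (refl , refl) → refl }) (λ { refl → refl , refl }) ((A ≟ C) ×-dec (B ≟ D))
(A ⋁ B) ≟ (C ⋁ D) = map′ (λ { (refl , refl) → refl }) (λ { refl → refl , refl }) ((A ≟ C) ×-dec (B ≟ D))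
(A ⊃ B) ≟ (C ⊃ D) = map′ (λ { (refl , refl) → refl }) (λ { refl → refl , refl }) ((A ≟ C) ×-dec (B ≟ D))
var _ ≟ falsum = no λ ()
var _ ≟ (_ ⋀ _) = no λ ()
var _ ≟ (_ ⋁ _) = no λ ()
var _ ≟ (_ ⊃ _) = no λ ()
falsum ≟ var _ = no λ ()
falsum ≟ (_ ⋀ _) = no λ ()
falsum ≟ (_ ⋁ _) = no λ ()
falsum ≟ (_ ⊃ _) = no λ ()
(_ ⋀ _) ≟ var _ = no λ ()
(_ ⋀ _) ≟ falsum = no λ ()
(_ ⋀ _) ≟ (_ ⋁ _) = no λ ()
(_ ⋀ _) ≟ (_ ⊃ _) = no λ ()
(_ ⋁ _) ≟ var _ = no λ ()
(_ ⋁ _) ≟ falsum = no λ ()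
(_ ⋁ _) ≟ (_ ⋀ _) = no λ ()
(_ ⋁ _) ≟ (_ ⊃ _) = no λ ()
(_ ⊃ _) ≟ var _ = no λ ()
(_ ⊃ _) ≟ falsum = no λ ()
(_ ⊃ _) ≟ (_ ⋀ _) = no λ ()
(_ ⊃ _) ≟ (_ ⋁ _) = no λ ()

open import Data.List.Membership.DecPropositional _≟_ using (_∈?_)
open import Data.List.Relation.Binary.Subset.DecPropositional _≟_ using (_⊆?_)

IsVar? : ∀ A → Dec (IsVar A)
IsVar? (var n) = yes (isVar n)
IsVar? falsum = no λ ()
IsVar? (_ ⋀ _) = no λ ()
IsVar? (_ ⋁ _) = no λ ()
IsVar? (_ ⊃ _) = no λ ()

IsImp? : ∀ A → Dec (IsImp A)
IsImp? (A ⊃ B) = yes (isImp A B)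
IsImp? (var _) = no λ ()
IsImp? falsum = no λ ()
IsImp? (_ ⋀ _) = no λ ()
IsImp? (_ ⋁ _) = no λ ()

VBot? : ∀ A → Dec (VBot A)
VBot? A = IsVar? A ⊎-dec (A ≟ falsum)

Cl-mono : ∀ {Γ Δ A} → Γ ⊆ Δ → Cl Γ A → Cl Δ A
Cl-mono Γ⊆Δ (cl-base A∈) = cl-base (Γ⊆Δ A∈)
Cl-mono Γ⊆Δ (cl-∧ a b) = cl-∧ (Cl-mono Γ⊆Δ a) (Cl-mono Γ⊆Δ b)
Cl-mono Γ⊆Δ (cl-∨l A a) = cl-∨l A (Cl-mono Γ⊆Δ a)
Cl-mono Γ⊆Δ (cl-∨r A a) = cl-∨r A (Cl-mono Γ⊆Δ a)
Cl-mono Γ⊆Δ (cl-⊃ A a) = cl-⊃ A (Cl-mono Γ⊆Δ a)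

Cl? : ∀ Γ A → Dec (Cl Γ A)
Cl? Γ A with A ∈? Γ
... | yes A∈ = yes (cl-base A∈)
Cl? Γ (var _) | no A∉ = no λ { (cl-base A∈) → A∉ A∈ }
Cl? Γ falsum | no A∉ = no λ { (cl-base A∈) → A∉ A∈ }
Cl? Γ (A ⋀ B) | no A∉ with Cl? Γ A | Cl? Γ B
... | yes a | yes b = yes (cl-∧ a b)
... | no ¬a | _ = no λ { (cl-base A∈) → A∉ A∈ ; (cl-∧ a _) → ¬a a }
... | yes _ | no ¬b = no λ { (cl-base A∈) → A∉ A∈ ; (cl-∧ _ b) → ¬b b }
Cl? Γ (A ⋁ B) | no A∉ with Cl? Γ A | Cl? Γ B
... | yes a | _ = yes (cl-∨r B a)
... | no _ | yes b = yes (cl-∨l A b)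
... | no ¬a | no ¬b = no λ { (cl-base A∈) → A∉ A∈ ; (cl-∨l _ b) → ¬b b ; (cl-∨r _ a) → ¬a a }
Cl? Γ (A ⊃ B) | no A∉ with Cl? Γ B
... | yes b = yes (cl-⊃ A b)
... | no ¬b = no λ { (cl-base A∈) → A∉ A∈ ; (cl-⊃ _ b) → ¬b b }

≐-refl : ∀ {xs} → xs ≐ xs
≐-refl = ⊆-refl , ⊆-refl

≐-sym : ∀ {xs ys} → xs ≐ ys → ys ≐ xs
≐-sym (xs⊆ys , ys⊆xs) = ys⊆xs , xs⊆ys

≐-trans : ∀ {xs ys zs} → xs ≐ ys → ys ≐ zs → xs ≐ zs
≐-trans (a , b) (c , d) = ⊆-trans a c , ⊆-trans d b

_≐?_ : ∀ xs ys → Dec (xs ≐ ys)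
xs ≐? ys = (xs ⊆? ys) ×-dec (ys ⊆? xs)

filter-≈ₚ : ∀ {P : Fm → Set} (P? : ∀ x → Dec (P x)) xs → (∀ {x} → P x → x ∈ xs) → filter P? xs ≈ₚ P
filter-≈ₚ P? xs P⊆xs x = proj₂ ∘ ∈-filter⁻ P? {xs = xs} , λ p → ∈-filter⁺ P? (P⊆xs p) p

infixl 6 _∖_ _∩_

_∖_ : List Fm → List Fm → List Fm
xs ∖ ys = filter (λ x → ¬? (x ∈? ys)) xs

++-≐ : ∀ {ws xs ys zs} → ws ≐ xs → ys ≐ zs → (ws ++ ys) ≐ (xs ++ zs)
++-≐ (a , b) (c , d) = ++-⊆ a c , ++-⊆ b d

_∩_ : List Fm → List Fm → List Fm
xs ∩ ys = filter (_∈? ys) xs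

∈-∖⁺ : ∀ {x xs ys} → x ∈ xs → x ∉ ys → x ∈ xs ∖ ys
∈-∖⁺ = ∈-filter⁺ (λ x → ¬? (x ∈? _))

∈-∖⁻ : ∀ {x} xs ys → x ∈ xs ∖ ys → x ∈ xs × x ∉ ys
∈-∖⁻ xs ys = ∈-filter⁻ (λ x → ¬? (x ∈? ys)) {xs = xs}

∖-≐ : ∀ {xs ys} → ys ⊆ xs → xs ≐ ((xs ∖ ys) ++ ys)
∖-≐ {xs} {ys} ys⊆xs = split , [ proj₁ ∘ ∈-∖⁻ xs ys , ys⊆xs ]′ ∘ ∈-++⁻ (xs ∖ ys)
  where
    split : xs ⊆ (xs ∖ ys) ++ ys
    split {x} x∈ with x ∈? ys
    ... | yes x∈ys = ∈-++⁺ʳ (xs ∖ ys) x∈ys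
    ... | no x∉ys = ∈-++⁺ˡ (∈-∖⁺ x∈ x∉ys)

∩-≈ₚ : ∀ xs ys → (xs ∩ ys) ≈ₚ (λ x → x ∈ xs × x ∈ ys)
∩-≈ₚ xs ys x = ∈-filter⁻ (_∈? ys) {xs = xs} , λ (x∈xs , x∈ys) → ∈-filter⁺ (_∈? ys) x∈xs x∈ys

++-≈ₚ : ∀ xs ys → (xs ++ ys) ≈ₚ (λ x → x ∈ xs ⊎ x ∈ ys)
++-≈ₚ xs ys x = ∈-++⁻ xs , [ ∈-++⁺ˡ , ∈-++⁺ʳ xs ]′

Minimal : List Fm → List Fm → Fm → Set
Minimal Σ Λ A = ∀ Λ′ → Λ′ ⊂ Λ → ¬ Cl (Σ ++ Λ′) A

-- Since Cl is monotone, it suffices to check the sublists missing one element.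
Minimal? : ∀ Σ Λ A → Dec (Minimal Σ Λ A)
Minimal? Σ Λ A = map′ dropOne⇒Minimal Minimal⇒dropOne
  (All.all? (λ x → ¬? (Cl? (Σ ++ Λ ∖ (x ∷ [])) A)) Λ)
  where
    dropOne⇒Minimal : All (λ x → ¬ Cl (Σ ++ Λ ∖ (x ∷ [])) A) Λ → Minimal Σ Λ A
    dropOne⇒Minimal a Λ′ (Λ′⊆Λ , Λ⊈Λ′) c with ⊈⇒∃∉ _≟_ Λ⊈Λ′
    ... | x , x∈Λ , x∉Λ′ = All.lookup a x∈Λ (Cl-mono (++⁺ʳ-⊆ Σ Λ′⊆Λ∖x) c)
      where
        Λ′⊆Λ∖x : Λ′ ⊆ Λ ∖ (x ∷ [])
        Λ′⊆Λ∖x y∈ = ∈-∖⁺ (Λ′⊆Λ y∈) λ { (here refl) → x∉Λ′ y∈ }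
    Minimal⇒dropOne : Minimal Σ Λ A → All (λ x → ¬ Cl (Σ ++ Λ ∖ (x ∷ [])) A) Λ
    Minimal⇒dropOne m = All.tabulate λ {x} x∈Λ →
      m (Λ ∖ (x ∷ []))
        (proj₁ ∘ ∈-∖⁻ Λ (x ∷ []) , λ Λ⊆ → proj₂ (∈-∖⁻ Λ (x ∷ []) (Λ⊆ x∈Λ)) (here refl))

⊑-refl : ∀ {σ} → σ ⊑ σ
⊑-refl {reg _ _} = refl , ⊆-refl
⊑-refl {irr _ _ _} = ≐-refl , refl , ⊆-refl

⊑-trans : ∀ {σ τ ρ} → σ ⊑ τ → τ ⊑ ρ → σ ⊑ ρ
⊑-trans {reg _ _} {reg _ _} {reg _ _} (refl , a) (refl , b) = refl , ⊆-trans a b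
⊑-trans {irr _ _ _} {irr _ _ _} {irr _ _ _} (e , refl , a) (e′ , refl , b) = ≐-trans e e′ , refl , ⊆-trans a b

reg-⊑ : ∀ {Γ Δ C} → Γ ⊆ Δ → reg Γ C ⊑ reg Δ C
reg-⊑ Γ⊆Δ = refl , Γ⊆Δ

irr-⊑ : ∀ {Σ Σ′ Θ Θ′ C} → Σ ≐ Σ′ → Θ ⊆ Θ′ → irr Σ Θ C ⊑ irr Σ′ Θ′ C
irr-⊑ Σ≐Σ′ Θ⊆Θ′ = Σ≐Σ′ , refl , Θ⊆Θ′

_⊑?_ : ∀ σ τ → Dec (σ ⊑ τ)
reg Γ C ⊑? reg Δ D = (C ≟ D) ×-dec (Γ ⊆? Δ)
irr Σ Θ C ⊑? irr Σ′ Θ′ D = (Σ ≐? Σ′) ×-dec ((C ≟ D) ×-dec (Θ ⊆? Θ′))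
reg _ _ ⊑? irr _ _ _ = no λ ()
irr _ _ _ ⊑? reg _ _ = no λ ()

irregulars : List Seq → List Prem
irregulars [] = []
irregulars (reg _ _ ∷ L) = irregulars L
irregulars (irr Σ Θ C ∷ L) = (Σ , Θ , C) ∷ irregulars L

∈-irregulars⁺ : ∀ {Σ Θ C L} → irr Σ Θ C ∈ L → (Σ , Θ , C) ∈ irregulars L
∈-irregulars⁺ {L = irr _ _ _ ∷ _} (here refl) = here refl
∈-irregulars⁺ {L = reg _ _ ∷ _} (there p∈) = ∈-irregulars⁺ p∈
∈-irregulars⁺ {L = irr _ _ _ ∷ _} (there p∈) = there (∈-irregulars⁺ p∈)

∈-irregulars⁻ : ∀ {j} L → j ∈ irregulars L → toIrr j ∈ L
∈-irregulars⁻ (reg _ _ ∷ L) j∈ = there (∈-irregulars⁻ L j∈)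
∈-irregulars⁻ (irr _ _ _ ∷ L) (here refl) = here refl
∈-irregulars⁻ (irr _ _ _ ∷ L) (there j∈) = there (∈-irregulars⁻ L j∈)

Subsumed : List Seq → Seq → Set
Subsumed L σ = Any (σ ⊑_) L

reg-subsumer : ∀ {L Γ C} → Subsumed L (reg Γ C) → Σ[ Γ′ ∈ List Fm ] (reg Γ′ C ∈ L × Γ ⊆ Γ′)
reg-subsumer s with find s
... | reg Γ′ _ , q∈ , (refl , Γ⊆) = Γ′ , q∈ , Γ⊆
... | irr _ _ _ , _ , ()

irr-subsumer : ∀ {L Σ Θ C} → Subsumed L (irr Σ Θ C) →
               Σ[ Σ′ ∈ List Fm ] Σ[ Θ′ ∈ List Fm ] (irr Σ′ Θ′ C ∈ L × Σ ≐ Σ′ × Θ ⊆ Θ′)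
irr-subsumer s with find s
... | irr Σ′ Θ′ _ , q∈ , (Σ≐ , refl , Θ⊆) = Σ′ , Θ′ , q∈ , Σ≐ , Θ⊆
... | reg _ _ , _ , ()

module FSearch (G : Fm) where

  Side : Bool → Fm → Set
  Side true = Sr G
  Side false = Sl G

  mutual
    signedSubformulas : Bool → Fm → List (Bool × Fm)
    signedSubformulas s A = (s , A) ∷ signedProperSubformulas s A

    signedProperSubformulas : Bool → Fm → List (Bool × Fm)
    signedProperSubformulas s (A ⋀ B) = signedSubformulas s A ++ signedSubformulas s B
    signedProperSubformulas s (A ⋁ B) = signedSubformulas s A ++ signedSubformulas s B
    signedProperSubformulas s (A ⊃ B) = signedSubformulas s B ++ signedSubformulas (not s) A
    signedProperSubformulas s (var _) = []
    signedProperSubformulas s falsum = []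

  mutual
    signedSubformulas-sound : ∀ s A {t X} → Side s A → (t , X) ∈ signedSubformulas s A → Side t X
    signedSubformulas-sound s A a (here refl) = a
    signedSubformulas-sound s A a (there m) = signedProperSubformulas-sound s A a m

    signedProperSubformulas-sound : ∀ s A {t X} → Side s A → (t , X) ∈ signedProperSubformulas s A → Side t X
    signedProperSubformulas-sound true (A ⋀ B) a m with ∈-++⁻ (signedSubformulas true A) m
    ... | inj₁ m′ = signedSubformulas-sound true A (sr-∧₁ a) m′
    ... | inj₂ m′ = signedSubformulas-sound true B (sr-∧₂ a) m′
    signedProperSubformulas-sound false (A ⋀ B) a m with ∈-++⁻ (signedSubformulas false A) m
    ... | inj₁ m′ = signedSubformulas-sound false A (sl-∧₁ a) m′
    ... | inj₂ m′ = signedSubformulas-sound false B (sl-∧₂ a) m′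
    signedProperSubformulas-sound true (A ⋁ B) a m with ∈-++⁻ (signedSubformulas true A) m
    ... | inj₁ m′ = signedSubformulas-sound true A (sr-∨₁ a) m′
    ... | inj₂ m′ = signedSubformulas-sound true B (sr-∨₂ a) m′
    signedProperSubformulas-sound false (A ⋁ B) a m with ∈-++⁻ (signedSubformulas false A) m
    ... | inj₁ m′ = signedSubformulas-sound false A (sl-∨₁ a) m′
    ... | inj₂ m′ = signedSubformulas-sound false B (sl-∨₂ a) m′
    signedProperSubformulas-sound true (A ⊃ B) a m with ∈-++⁻ (signedSubformulas true B) m
    ... | inj₁ m′ = signedSubformulas-sound true B (sr-⊃ a) m′
    ... | inj₂ m′ = signedSubformulas-sound false A (sr-⊃l a) m′
    signedProperSubformulas-sound false (A ⊃ B) a m with ∈-++⁻ (signedSubformulas false B) m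
    ... | inj₁ m′ = signedSubformulas-sound false B (sl-⊃ a) m′
    ... | inj₂ m′ = signedSubformulas-sound true A (sl-⊃l a) m′

  mutual
    signedSubformulas-trans : ∀ s A {t B} → (t , B) ∈ signedSubformulas s A →
                              signedSubformulas t B ⊆ signedSubformulas s A
    signedSubformulas-trans s A (here refl) = λ m → m
    signedSubformulas-trans s A (there m) = λ m′ → there (signedProperSubformulas-trans s A m m′)

    signedProperSubformulas-trans : ∀ s A {t B} → (t , B) ∈ signedProperSubformulas s A →
                                    signedSubformulas t B ⊆ signedProperSubformulas s A
    signedProperSubformulas-trans s (A ⋀ B) m with ∈-++⁻ (signedSubformulas s A) m
    ... | inj₁ m′ = λ n → ∈-++⁺ˡ (signedSubformulas-trans s A m′ n)
    ... | inj₂ m′ = λ n → ∈-++⁺ʳ (signedSubformulas s A) (signedSubformulas-trans s B m′ n)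
    signedProperSubformulas-trans s (A ⋁ B) m with ∈-++⁻ (signedSubformulas s A) m
    ... | inj₁ m′ = λ n → ∈-++⁺ˡ (signedSubformulas-trans s A m′ n)
    ... | inj₂ m′ = λ n → ∈-++⁺ʳ (signedSubformulas s A) (signedSubformulas-trans s B m′ n)
    signedProperSubformulas-trans s (A ⊃ B) m with ∈-++⁻ (signedSubformulas s B) m
    ... | inj₁ m′ = λ n → ∈-++⁺ˡ (signedSubformulas-trans s B m′ n)
    ... | inj₂ m′ = λ n → ∈-++⁺ʳ (signedSubformulas s B) (signedSubformulas-trans (not s) A m′ n)

  signedUniverse : List (Bool × Fm)
  signedUniverse = signedSubformulas true G

  private
    child : ∀ {s A t B} → (s , A) ∈ signedUniverse → (t , B) ∈ signedProperSubformulas s A →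
            (t , B) ∈ signedUniverse
    child A∈ B∈ = signedSubformulas-trans true G A∈ (there B∈)

    first : ∀ {s A} (xs : List (Bool × Fm)) → (s , A) ∈ signedSubformulas s A ++ xs
    first _ = here refl

    second : ∀ {s A} (xs : List (Bool × Fm)) → (s , A) ∈ xs ++ signedSubformulas s A
    second xs = ∈-++⁺ʳ xs (here refl)

  mutual
    Sl⇒∈signedUniverse : ∀ {A} → Sl G A → (false , A) ∈ signedUniverse
    Sl⇒∈signedUniverse (sl-∧₁ a) = child (Sl⇒∈signedUniverse a) (first _)
    Sl⇒∈signedUniverse (sl-∧₂ {A} a) = child (Sl⇒∈signedUniverse a) (second (signedSubformulas false A))
    Sl⇒∈signedUniverse (sl-∨₁ a) = child (Sl⇒∈signedUniverse a) (first _)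
    Sl⇒∈signedUniverse (sl-∨₂ {A} a) = child (Sl⇒∈signedUniverse a) (second (signedSubformulas false A))
    Sl⇒∈signedUniverse (sl-⊃ a) = child (Sl⇒∈signedUniverse a) (first _)
    Sl⇒∈signedUniverse (sr-⊃l {B = B} a) = child (Sr⇒∈signedUniverse a) (second (signedSubformulas true B))

    Sr⇒∈signedUniverse : ∀ {A} → Sr G A → (true , A) ∈ signedUniverse
    Sr⇒∈signedUniverse sr-top = here refl
    Sr⇒∈signedUniverse (sr-∧₁ a) = child (Sr⇒∈signedUniverse a) (first _)
    Sr⇒∈signedUniverse (sr-∧₂ {A} a) = child (Sr⇒∈signedUniverse a) (second (signedSubformulas true A))
    Sr⇒∈signedUniverse (sr-∨₁ a) = child (Sr⇒∈signedUniverse a) (first _)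
    Sr⇒∈signedUniverse (sr-∨₂ {A} a) = child (Sr⇒∈signedUniverse a) (second (signedSubformulas true A))
    Sr⇒∈signedUniverse (sr-⊃ a) = child (Sr⇒∈signedUniverse a) (first _)
    Sr⇒∈signedUniverse (sl-⊃l {B = B} a) = child (Sl⇒∈signedUniverse a) (second (signedSubformulas false B))

  Side? : ∀ s A → Dec (Side s A)
  Side? s A = map′ (signedSubformulas-sound true G sr-top) (Side⇒∈signedUniverse s)
                   (Any.any? (×-≡-dec Bool._≟_ _≟_ (s , A)) signedUniverse)
    where
      Side⇒∈signedUniverse : ∀ s → Side s A → (s , A) ∈ signedUniverse
      Side⇒∈signedUniverse true = Sr⇒∈signedUniverse
      Side⇒∈signedUniverse false = Sl⇒∈signedUniverse

  Sl? : ∀ A → Dec (Sl G A)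
  Sl? = Side? false

  Sr? : ∀ A → Dec (Sr G A)
  Sr? = Side? true

  universe : List Fm
  universe = map proj₂ signedUniverse

  Sl⇒∈universe : ∀ {A} → Sl G A → A ∈ universe
  Sl⇒∈universe a = ∈-map⁺ proj₂ (Sl⇒∈signedUniverse a)

  Sr⇒∈universe : ∀ {A} → Sr G A → A ∈ universe
  Sr⇒∈universe a = ∈-map⁺ proj₂ (Sr⇒∈signedUniverse a)

  Γbar? : ∀ A → Dec (Γbar G A)
  Γbar? A = (Sl? A ×-dec IsVar? A) ⊎-dec (Sl? A ×-dec IsImp? A)

  Γbar⇒∈universe : ∀ {A} → Γbar G A → A ∈ universe
  Γbar⇒∈universe (inj₁ (a , _)) = Sl⇒∈universe a
  Γbar⇒∈universe (inj₂ (a , _)) = Sl⇒∈universe a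

  ⊆Γbar : List Fm → Set
  ⊆Γbar Γ = ∀ x → x ∈ Γ → Γbar G x

  ⊆Γbar? : ∀ Γ → Dec (⊆Γbar Γ)
  ⊆Γbar? Γ = map′ (λ a x → All.lookup a) (λ f → All.tabulate (f _)) (All.all? Γbar? Γ)

  ⊆Γbar-⊆ : ∀ {Γ Δ} → Γ ⊆ Δ → ⊆Γbar Δ → ⊆Γbar Γ
  ⊆Γbar-⊆ Γ⊆Δ δ x = δ x ∘ Γ⊆Δ

  ⊆Γbar-++ : ∀ {Γ Δ} → ⊆Γbar Γ → ⊆Γbar Δ → ⊆Γbar (Γ ++ Δ)
  ⊆Γbar-++ {Γ} γ δ x x∈ = [ γ x , δ x ]′ (∈-++⁻ Γ x∈)

  universe∩-≐ : ∀ {Γ} → ⊆Γbar Γ → (universe ∩ Γ) ≐ Γ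
  universe∩-≐ {Γ} γ = proj₂ ∘ proj₁ (∩-≈ₚ universe Γ _) ,
                      λ {x} x∈ → proj₂ (∩-≈ₚ universe Γ x) (Γbar⇒∈universe (γ x x∈) , x∈)

  setOf : ∀ {P : Fm → Set} → (∀ x → Dec (P x)) → List Fm
  setOf P? = filter P? universe

  setOf-≈ₚ : ∀ {P : Fm → Set} (P? : ∀ x → Dec (P x)) → (∀ {x} → P x → Γbar G x) → setOf P? ≈ₚ P
  setOf-≈ₚ P? P⇒Γbar = filter-≈ₚ P? universe (Γbar⇒∈universe ∘ P⇒Γbar)

  setOf-⊆Γbar : ∀ {P : Fm → Set} (P? : ∀ x → Dec (P x)) → (∀ {x} → P x → Γbar G x) → ⊆Γbar (setOf P?)
  setOf-⊆Γbar P? P⇒Γbar x x∈ = P⇒Γbar (proj₁ (setOf-≈ₚ P? P⇒Γbar x) x∈)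

  Applications : List Seq → Set
  Applications ps = List (Σ Seq (Step G ps))

  Covers : ∀ {ps} → Applications ps → Seq → Set
  Covers as σ = Any (λ a → σ ⊑ proj₁ a) as

  -- Abstract, so that applyIf P? σ step stays rigid and its arguments are inferred from a Covers goal.
  abstract
    applyIf : ∀ {ps} {P : Set} → Dec P → (σ : Seq) → (P → Step G ps σ) → Applications ps
    applyIf (yes p) σ step = (σ , step p) ∷ []
    applyIf (no _) σ step = []

    applyIf-covers : ∀ {ps P} (P? : Dec P) σ (step : P → Step G ps σ) {τ} →
                     P → τ ⊑ σ → Covers (applyIf P? σ step) τ
    applyIf-covers (yes _) σ step p τ⊑σ = here τ⊑σ
    applyIf-covers (no ¬p) σ step p τ⊑σ = ⊥-elim (¬p p)

  -- Instances of the rules, up to subsumption of the conclusion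

  ΓAt? : ∀ x → Dec (ΓAt G x)
  ΓAt? x = Sl? x ×-dec IsVar? x

  ΓImp? : ∀ x → Dec (ΓImp G x)
  ΓImp? x = Sl? x ×-dec IsImp? x

  ⊆setOf : ∀ {P : Fm → Set} (P? : ∀ x → Dec (P x)) → (∀ {x} → P x → Γbar G x) →
           ∀ {Γ} → (∀ {x} → x ∈ Γ → P x) → Γ ⊆ setOf P?
  ⊆setOf P? P⇒Γbar Γ⇒P {x} x∈ = proj₂ (setOf-≈ₚ P? P⇒Γbar x) (Γ⇒P x∈)

  module _ (F : Fm) where

    AxiomAtom : Fm → Set
    AxiomAtom x = ΓAt G x × x ≢ F

    AxiomAtom? : ∀ x → Dec (AxiomAtom x)
    AxiomAtom? x = ΓAt? x ×-dec ¬? (x ≟ F)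

    AxiomAny : Fm → Set
    AxiomAny x = AxiomAtom x ⊎ ΓImp G x

    AxiomAny? : ∀ x → Dec (AxiomAny x)
    AxiomAny? x = AxiomAtom? x ⊎-dec ΓImp? x

    AxiomAtom⇒Γbar : ∀ {x} → AxiomAtom x → Γbar G x
    AxiomAtom⇒Γbar (a , _) = inj₁ a

    AxiomAny⇒Γbar : ∀ {x} → AxiomAny x → Γbar G x
    AxiomAny⇒Γbar = [ AxiomAtom⇒Γbar , inj₂ ]′

    axiomInstances : Applications []
    axiomInstances =
      applyIf (VBot? F ×-dec Sr? F) (reg (setOf AxiomAtom?) F)
        (λ (v , sr) → (setOf-⊆Γbar AxiomAtom? AxiomAtom⇒Γbar , sr) ,
                      ax-reg v (setOf-≈ₚ AxiomAtom? AxiomAtom⇒Γbar)) ++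
      applyIf (VBot? F ×-dec Sr? F) (irr [] (setOf AxiomAny?) F)
        (λ (v , sr) → ((λ _ ()) , setOf-⊆Γbar AxiomAny? AxiomAny⇒Γbar , sr) ,
                      ax-irr v (setOf-≈ₚ AxiomAny? AxiomAny⇒Γbar))

  nullaryInstances : Applications []
  nullaryInstances = concatMap axiomInstances universe

  ax-reg-covered : ∀ {Γ F} → WF G (reg Γ F) → VBot F → Γ ≈ₚ AxiomAtom F → Covers nullaryInstances (reg Γ F)
  ax-reg-covered {Γ} {F} (_ , sr) v Γ≈ =
    Any-concatMap⁺ axiomInstances (Sr⇒∈universe sr) (++⁺ˡ (applyIf-covers _ _ _ (v , sr) (reg-⊑ Γ⊆)))
    where
      Γ⊆ : Γ ⊆ setOf (AxiomAtom? F)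
      Γ⊆ = ⊆setOf (AxiomAtom? F) (AxiomAtom⇒Γbar F) (λ {x} → proj₁ (Γ≈ x))

  ax-irr-covered : ∀ {Θ F} → WF G (irr [] Θ F) → VBot F → Θ ≈ₚ AxiomAny F →
                   Covers nullaryInstances (irr [] Θ F)
  ax-irr-covered {Θ} {F} (_ , _ , sr) v Θ≈ =
    Any-concatMap⁺ axiomInstances (Sr⇒∈universe sr) (++⁺ʳ _ (applyIf-covers _ _ _ (v , sr) (irr-⊑ ≐-refl Θ⊆)))
    where
      Θ⊆ : Θ ⊆ setOf (AxiomAny? F)
      Θ⊆ = ⊆setOf (AxiomAny? F) (AxiomAny⇒Γbar F) (λ {x} → proj₁ (Θ≈ x))

  Admits : List Fm → Fm → Set
  Admits Γ x = Cl Γ x × Γbar G x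

  Admits? : ∀ Γ x → Dec (Admits Γ x)
  Admits? Γ x = Cl? Γ x ×-dec Γbar? x

  Admissible : List Fm → List Fm → Set
  Admissible Γ Θ = ∀ x → x ∈ Θ → Admits Γ x

  Admissible? : ∀ Γ Θ → Dec (Admissible Γ Θ)
  Admissible? Γ Θ = map′ (λ a x → All.lookup a) (λ f → All.tabulate (f _)) (All.all? (Admits? Γ) Θ)

  -- Greedily extends Θ by admissible formulas while keeping A out of its closure.
  module Avoiding (Γ : List Fm) (A : Fm) where

    extend : List Fm → List Fm → List Fm
    extend Θ [] = Θ
    extend Θ (x ∷ xs) with Admits? Γ x ×-dec ¬? (Cl? (Θ ++ x ∷ []) A)
    ... | yes _ = extend (Θ ++ x ∷ []) xs
    ... | no _ = extend Θ xs

    ⊆-extend : ∀ Θ xs → Θ ⊆ extend Θ xs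
    ⊆-extend Θ [] = ⊆-refl
    ⊆-extend Θ (x ∷ xs) with Admits? Γ x ×-dec ¬? (Cl? (Θ ++ x ∷ []) A)
    ... | yes _ = ⊆-trans ∈-++⁺ˡ (⊆-extend (Θ ++ x ∷ []) xs)
    ... | no _ = ⊆-extend Θ xs

    extend-admissible : ∀ Θ xs → Admissible Γ Θ → Admissible Γ (extend Θ xs)
    extend-admissible Θ [] adm = adm
    extend-admissible Θ (x ∷ xs) adm with Admits? Γ x ×-dec ¬? (Cl? (Θ ++ x ∷ []) A)
    ... | yes (admx , _) = extend-admissible (Θ ++ x ∷ []) xs
                             (λ y y∈ → [ adm y , (λ { (here refl) → admx }) ]′ (∈-++⁻ Θ y∈))
    ... | no _ = extend-admissible Θ xs adm

    extend-avoids : ∀ Θ xs → ¬ Cl Θ A → ¬ Cl (extend Θ xs) A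
    extend-avoids Θ [] ¬c = ¬c
    extend-avoids Θ (x ∷ xs) ¬c with Admits? Γ x ×-dec ¬? (Cl? (Θ ++ x ∷ []) A)
    ... | yes (_ , ¬c′) = extend-avoids (Θ ++ x ∷ []) xs ¬c′
    ... | no _ = extend-avoids Θ xs ¬c

    extend-saturates : ∀ Θ xs {x} → x ∈ xs → Admits Γ x →
                       x ∈ extend Θ xs ⊎ Cl (extend Θ xs ++ x ∷ []) A
    extend-saturates Θ (y ∷ xs) x∈ admx with Admits? Γ y ×-dec ¬? (Cl? (Θ ++ y ∷ []) A)
    extend-saturates Θ (y ∷ xs) (here refl) admx | yes _ =
      inj₁ (⊆-extend (Θ ++ y ∷ []) xs (∈-++⁺ʳ Θ (here refl)))
    extend-saturates Θ (y ∷ xs) (there x∈) admx | yes _ = extend-saturates (Θ ++ y ∷ []) xs x∈ admx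
    extend-saturates Θ (y ∷ xs) (here refl) admx | no ¬ok with Cl? (Θ ++ y ∷ []) A
    ... | yes c = inj₂ (Cl-mono (++⁺ˡ-⊆ (y ∷ []) (⊆-extend Θ xs)) c)
    ... | no ¬c = ⊥-elim (¬ok (admx , ¬c))
    extend-saturates Θ (y ∷ xs) (there x∈) admx | no _ = extend-saturates Θ xs x∈ admx

    maximal : List Fm → List Fm
    maximal Θ = extend Θ universe

    maximal-maximal : ∀ Θ Θ′ → maximal Θ ⊂ Θ′ → Admissible Γ Θ′ → Cl Θ′ A
    maximal-maximal Θ Θ′ (⊆Θ′ , Θ′⊈) adm with Cl? Θ′ A
    ... | yes c = c
    ... | no ¬c with ⊈⇒∃∉ _≟_ Θ′⊈
    ... | x , x∈Θ′ , x∉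
        with extend-saturates Θ universe (Γbar⇒∈universe (proj₂ (adm x x∈Θ′))) (adm x x∈Θ′)
    ... | inj₁ x∈ = ⊥-elim (x∉ x∈)
    ... | inj₂ c = ⊥-elim (¬c (Cl-mono ([ ⊆Θ′ , (λ { (here refl) → x∈Θ′ }) ]′ ∘ ∈-++⁻ (maximal Θ)) c))

  ∧-reg-instances : ∀ Γ B (X : Fm) → Applications (reg Γ B ∷ [])
  ∧-reg-instances Γ B (A₁ ⋀ A₂) =
    applyIf (((B ≟ A₁) ⊎-dec (B ≟ A₂)) ×-dec (Sr? (A₁ ⋀ A₂) ×-dec ⊆Γbar? Γ)) (reg Γ (A₁ ⋀ A₂))
      (λ (k , sr , γ) → (γ , sr) , ∧-reg k ≐-refl)
  ∧-reg-instances Γ B _ = []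

  ⊃∈-reg-instances : ∀ Γ B A → Applications (reg Γ B ∷ [])
  ⊃∈-reg-instances Γ B A =
    applyIf (Sr? (A ⊃ B) ×-dec (Cl? Γ A ×-dec ⊆Γbar? Γ)) (reg Γ (A ⊃ B))
      (λ (sr , c , γ) → (γ , sr) , ⊃∈-reg ≐-refl c)

  ⊃∉-instances : ∀ Γ B A Θ → Applications (reg Γ B ∷ [])
  ⊃∉-instances Γ B A Θ =
    applyIf (Sr? (A ⊃ B) ×-dec (Cl? Γ A ×-dec (Admissible? Γ Θ ×-dec ¬? (Cl? Θ A)))) (irr [] (maximal Θ) (A ⊃ B))
      (λ (sr , c , adm , ¬c) →
        ((λ _ ()) , (λ x → proj₂ ∘ extend-admissible Θ universe adm x) , sr) ,
        ⊃∉ (extend-admissible Θ universe adm) c (extend-avoids Θ universe ¬c) (maximal-maximal Θ))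
    where open Avoiding Γ A

  ∧-irr-instances : ∀ Σ Θ B (X : Fm) → Applications (irr Σ Θ B ∷ [])
  ∧-irr-instances Σ Θ B (A₁ ⋀ A₂) =
    applyIf (((B ≟ A₁) ⊎-dec (B ≟ A₂)) ×-dec (Sr? (A₁ ⋀ A₂) ×-dec (⊆Γbar? Σ ×-dec ⊆Γbar? Θ)))
      (irr Σ Θ (A₁ ⋀ A₂)) (λ (k , sr , σ , θ) → (σ , θ , sr) , ∧-irr k ≐-refl ≐-refl)
  ∧-irr-instances Σ Θ B _ = []

  ⊃∈-irr-instances : ∀ Σ Θ B A Λ → Applications (irr Σ Θ B ∷ [])
  ⊃∈-irr-instances Σ Θ B A Λ =
    applyIf (Sr? (A ⊃ B) ×-dec ((Λ ⊆? Θ) ×-dec (Cl? (Σ ++ Λ) A ×-dec (Minimal? Σ Λ A ×-dec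
             (⊆Γbar? (Σ ++ Λ) ×-dec ⊆Γbar? (Θ ∖ Λ))))))
      (irr (Σ ++ Λ) (Θ ∖ Λ) (A ⊃ B))
      (λ (sr , Λ⊆Θ , c , min , σ , θ) → (σ , θ , sr) ,
        ⊃∈-irr Λ (∖-≐ Λ⊆Θ) ≐-refl (λ x → proj₂ ∘ ∈-∖⁻ Θ Λ) c min)

  ∨-instances : ∀ Σ₁ Θ₁ C₁ Σ₂ Θ₂ C₂ → Applications (irr Σ₁ Θ₁ C₁ ∷ irr Σ₂ Θ₂ C₂ ∷ [])
  ∨-instances Σ₁ Θ₁ C₁ Σ₂ Θ₂ C₂ =
    applyIf (Sr? (C₁ ⋁ C₂) ×-dec ((Σ₁ ⊆? Σ₂ ++ Θ₂) ×-dec ((Σ₂ ⊆? Σ₁ ++ Θ₁) ×-dec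
             (⊆Γbar? (Σ₁ ++ Σ₂) ×-dec ⊆Γbar? (Θ₁ ∩ Θ₂)))))
      (irr (Σ₁ ++ Σ₂) (Θ₁ ∩ Θ₂) (C₁ ⋁ C₂))
      (λ (sr , c₁ , c₂ , σ , θ) → (σ , θ , sr) , ∨-irr (++-≈ₚ Σ₁ Σ₂) (∩-≈ₚ Θ₁ Θ₂) c₁ c₂)

  unaryInstances : ∀ p → Applications (p ∷ [])
  unaryInstances (reg Γ B) =
    concatMap (∧-reg-instances Γ B) universe ++ concatMap (⊃∈-reg-instances Γ B) universe ++
    concatMap (λ A → concatMap (⊃∉-instances Γ B A) (sublists universe)) universe
  unaryInstances (irr Σ Θ B) =
    concatMap (∧-irr-instances Σ Θ B) universe ++
    concatMap (λ A → concatMap (⊃∈-irr-instances Σ Θ B A) (sublists Θ)) universe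

  binaryInstances : ∀ p q → Applications (p ∷ q ∷ [])
  binaryInstances (irr Σ₁ Θ₁ C₁) (irr Σ₂ Θ₂ C₂) = ∨-instances Σ₁ Θ₁ C₁ Σ₂ Θ₂ C₂
  binaryInstances _ _ = []

  ∧-reg-covered : ∀ {Γ₀ Γ Γ′ A₁ A₂ Ak} → Sr G (A₁ ⋀ A₂) → ⊆Γbar Γ′ → (Ak ≡ A₁ ⊎ Ak ≡ A₂) →
                  Γ₀ ≐ Γ → Γ ⊆ Γ′ → Covers (unaryInstances (reg Γ′ Ak)) (reg Γ₀ (A₁ ⋀ A₂))
  ∧-reg-covered {Γ′ = Γ′} {Ak = Ak} sr γ k Γ₀≐Γ Γ⊆Γ′ =
    ++⁺ˡ (Any-concatMap⁺ (∧-reg-instances Γ′ Ak) (Sr⇒∈universe sr)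
      (applyIf-covers _ _ _ (k , sr , γ) (reg-⊑ (⊆-trans (proj₁ Γ₀≐Γ) Γ⊆Γ′))))

  ⊃∈-reg-covered : ∀ {Γ₀ Γ Γ′ A B} → Sr G (A ⊃ B) → ⊆Γbar Γ′ → Γ₀ ≐ Γ → Cl Γ A → Γ ⊆ Γ′ →
                   Covers (unaryInstances (reg Γ′ B)) (reg Γ₀ (A ⊃ B))
  ⊃∈-reg-covered {Γ′ = Γ′} {B = B} sr γ Γ₀≐Γ c Γ⊆Γ′ =
    ++⁺ʳ (concatMap (∧-reg-instances Γ′ B) universe)
      (++⁺ˡ (Any-concatMap⁺ (⊃∈-reg-instances Γ′ B) (Sl⇒∈universe (sr-⊃l sr))
        (applyIf-covers _ _ _ (sr , Cl-mono Γ⊆Γ′ c , γ) (reg-⊑ (⊆-trans (proj₁ Γ₀≐Γ) Γ⊆Γ′)))))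

  ⊃∉-covered : ∀ {Γ Γ′ Θ A B} → Sr G (A ⊃ B) → Admissible Γ Θ → Cl Γ A → ¬ Cl Θ A → Γ ⊆ Γ′ →
               Covers (unaryInstances (reg Γ′ B)) (irr [] Θ (A ⊃ B))
  ⊃∉-covered {Γ} {Γ′} {Θ} {A} {B} sr adm c ¬c Γ⊆Γ′ =
    ++⁺ʳ (concatMap (∧-reg-instances Γ′ B) universe) (++⁺ʳ (concatMap (⊃∈-reg-instances Γ′ B) universe)
      (Any-concatMap⁺ (λ A → concatMap (⊃∉-instances Γ′ B A) (sublists universe)) (Sl⇒∈universe (sr-⊃l sr))
        (Any-concatMap⁺ (⊃∉-instances Γ′ B A) (filter∈sublists (_∈? Θ) universe)
        (applyIf-covers _ _ _ (sr , Cl-mono Γ⊆Γ′ c , adm′ , ¬c ∘ Cl-mono (proj₁ Θ₀≐Θ))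
          (irr-⊑ ≐-refl (⊆-trans (proj₂ Θ₀≐Θ) (Avoiding.⊆-extend Γ′ A Θ₀ universe)))))))
    where
      Θ₀ : List Fm
      Θ₀ = universe ∩ Θ
      Θ₀≐Θ : Θ₀ ≐ Θ
      Θ₀≐Θ = universe∩-≐ (λ x → proj₂ ∘ adm x)
      adm′ : Admissible Γ′ Θ₀
      adm′ x x∈ = let (c , γ) = adm x (proj₁ Θ₀≐Θ x∈) in Cl-mono Γ⊆Γ′ c , γ

  ∧-irr-covered : ∀ {Σ₀ Σ Σ′ Θ₀ Θ Θ′ A₁ A₂ Ak} → Sr G (A₁ ⋀ A₂) → ⊆Γbar Σ′ → ⊆Γbar Θ′ →
                  (Ak ≡ A₁ ⊎ Ak ≡ A₂) → Σ₀ ≐ Σ → Θ₀ ≐ Θ → Σ ≐ Σ′ → Θ ⊆ Θ′ →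
                  Covers (unaryInstances (irr Σ′ Θ′ Ak)) (irr Σ₀ Θ₀ (A₁ ⋀ A₂))
  ∧-irr-covered {Σ′ = Σ′} {Θ′ = Θ′} {Ak = Ak} sr σ θ k Σ₀≐Σ Θ₀≐Θ Σ≐Σ′ Θ⊆Θ′ =
    ++⁺ˡ (Any-concatMap⁺ (∧-irr-instances Σ′ Θ′ Ak) (Sr⇒∈universe sr)
      (applyIf-covers _ _ _ (k , sr , σ , θ)
        (irr-⊑ (≐-trans Σ₀≐Σ Σ≐Σ′) (⊆-trans (proj₁ Θ₀≐Θ) Θ⊆Θ′))))

  ⊃∈-irr-covered : ∀ {Σ Θp Σc Θc Σ′ Θ′ A B} (Λ : List Fm) → Sr G (A ⊃ B) → ⊆Γbar Σ′ → ⊆Γbar Θ′ →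
                   Θp ≐ (Θc ++ Λ) → Σc ≐ (Σ ++ Λ) → (∀ x → x ∈ Θc → x ∉ Λ) →
                   Cl (Σ ++ Λ) A → Minimal Σ Λ A → Σ ≐ Σ′ → Θp ⊆ Θ′ →
                   Covers (unaryInstances (irr Σ′ Θ′ B)) (irr Σc Θc (A ⊃ B))
  ⊃∈-irr-covered {Σ} {Θp} {Σc} {Θc} {Σ′} {Θ′} {A} {B} Λ sr σ θ Θp≐ Σc≐ disjoint c min Σ≐Σ′ Θp⊆Θ′ =
    ++⁺ʳ (concatMap (∧-irr-instances Σ′ Θ′ B) universe)
      (Any-concatMap⁺ (λ A → concatMap (⊃∈-irr-instances Σ′ Θ′ B A) (sublists Θ′))
        (Sl⇒∈universe (sr-⊃l sr))
        (Any-concatMap⁺ (⊃∈-irr-instances Σ′ Θ′ B A) (filter∈sublists (_∈? Λ) Θ′)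
        (applyIf-covers _ _ _
          -- (λ {x} → …) delays elaboration until the side condition is known (otherwise {x} is inserted too early)
          (sr , (λ {x} → Λ′⊆Θ′) , Cl-mono (++-⊆ (proj₁ Σ≐Σ′) Λ⊆Λ′) c , min′ ,
           ⊆Γbar-++ σ (⊆Γbar-⊆ Λ′⊆Θ′ θ) , ⊆Γbar-⊆ ∖⊆ θ)
          (irr-⊑ (≐-trans Σc≐ (++-≐ Σ≐Σ′ (Λ⊆Λ′ , Λ′⊆Λ))) Θc⊆))))
    where
      Λ′ : List Fm
      Λ′ = Θ′ ∩ Λ
      Λ′⊆Θ′ : Λ′ ⊆ Θ′
      Λ′⊆Θ′ = proj₁ ∘ proj₁ (∩-≈ₚ Θ′ Λ _)
      Λ′⊆Λ : Λ′ ⊆ Λ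
      Λ′⊆Λ = proj₂ ∘ proj₁ (∩-≈ₚ Θ′ Λ _)
      Λ⊆Λ′ : Λ ⊆ Λ′
      Λ⊆Λ′ x∈ = proj₂ (∩-≈ₚ Θ′ Λ _) (Θp⊆Θ′ (proj₂ Θp≐ (∈-++⁺ʳ Θc x∈)) , x∈)
      min′ : Minimal Σ′ Λ′ A
      min′ Λ″ (Λ″⊆Λ′ , Λ′⊈Λ″) c′ =
        min Λ″ (⊆-trans Λ″⊆Λ′ Λ′⊆Λ , λ Λ⊆Λ″ → Λ′⊈Λ″ (⊆-trans Λ′⊆Λ Λ⊆Λ″))
          (Cl-mono (++⁺ˡ-⊆ Λ″ (proj₂ Σ≐Σ′)) c′)
      ∖⊆ : Θ′ ∖ Λ′ ⊆ Θ′
      ∖⊆ = proj₁ ∘ ∈-∖⁻ Θ′ Λ′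
      Θc⊆ : Θc ⊆ Θ′ ∖ Λ′
      Θc⊆ x∈ = ∈-∖⁺ (Θp⊆Θ′ (proj₂ Θp≐ (∈-++⁺ˡ x∈))) (disjoint _ x∈ ∘ Λ′⊆Λ)

  ∨-covered : ∀ {Σ₁ Θ₁ C₁ Σ₂ Θ₂ C₂ Σ Θ Σ₁′ Θ₁′ Σ₂′ Θ₂′} → Sr G (C₁ ⋁ C₂) →
              ⊆Γbar Σ₁′ → ⊆Γbar Θ₁′ → ⊆Γbar Σ₂′ →
              Σ ≈ₚ (λ x → x ∈ Σ₁ ⊎ x ∈ Σ₂) → Θ ≈ₚ (λ x → x ∈ Θ₁ × x ∈ Θ₂) →
              Σ₁ ⊆ (Σ₂ ++ Θ₂) → Σ₂ ⊆ (Σ₁ ++ Θ₁) →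
              Σ₁ ≐ Σ₁′ → Θ₁ ⊆ Θ₁′ → Σ₂ ≐ Σ₂′ → Θ₂ ⊆ Θ₂′ →
              Covers (∨-instances Σ₁′ Θ₁′ C₁ Σ₂′ Θ₂′ C₂) (irr Σ Θ (C₁ ⋁ C₂))
  ∨-covered {Σ₁} {Θ₁} {C₁} {Σ₂} {Θ₂} {C₂} {Σ} {Θ} {Σ₁′} {Θ₁′} {Σ₂′} {Θ₂′}
            sr σ₁ θ₁ σ₂ Σ≈ Θ≈ c₁ c₂ Σ₁≐ Θ₁⊆ Σ₂≐ Θ₂⊆ =
    applyIf-covers _ _ _
      (sr , (λ {x} → ⊆-trans (proj₂ Σ₁≐) (⊆-trans c₁ (++-⊆ (proj₁ Σ₂≐) Θ₂⊆))) ,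
            (λ {x} → ⊆-trans (proj₂ Σ₂≐) (⊆-trans c₂ (++-⊆ (proj₁ Σ₁≐) Θ₁⊆))) ,
            ⊆Γbar-++ σ₁ σ₂ , ⊆Γbar-⊆ (proj₁ ∘ proj₁ (∩-≈ₚ Θ₁′ Θ₂′ _)) θ₁)
      (irr-⊑ Σ≐ Θ⊆)
    where
      Σ≐ : Σ ≐ (Σ₁′ ++ Σ₂′)
      Σ≐ = (λ {x} x∈ → [ ∈-++⁺ˡ ∘ proj₁ Σ₁≐ , ∈-++⁺ʳ Σ₁′ ∘ proj₁ Σ₂≐ ]′ (proj₁ (Σ≈ x) x∈)) ,
           (λ {x} x∈ → proj₂ (Σ≈ x) ([ inj₁ ∘ proj₂ Σ₁≐ , inj₂ ∘ proj₂ Σ₂≐ ]′ (∈-++⁻ Σ₁′ x∈)))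
      Θ⊆ : Θ ⊆ Θ₁′ ∩ Θ₂′
      Θ⊆ {x} x∈ = let (x∈₁ , x∈₂) = proj₁ (Θ≈ x) x∈ in
                  proj₂ (∩-≈ₚ Θ₁′ Θ₂′ x) (Θ₁⊆ x∈₁ , Θ₂⊆ x∈₂)

  ∃? : ∀ {R : Fm → Set} → (∀ Z → Dec (R Z)) → (∀ {Z} → R Z → Z ∈ universe) → Dec (∃ R)
  ∃? R? R⇒∈ = map′ (λ a → let (Z , _ , r) = find a in Z , r) (λ (Z , r) → lose (R⇒∈ r) r)
                   (Any.any? R? universe)

  Antecedent : Fm → Set
  Antecedent Y = Σ[ Z ∈ Fm ] Sl G (Y ⊃ Z)

  Antecedent? : ∀ Y → Dec (Antecedent Y)
  Antecedent? Y = ∃? (λ Z → Sl? (Y ⊃ Z)) (Sl⇒∈universe ∘ sl-⊃)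

  Disjunct : Fm → Set
  Disjunct Y = Antecedent Y ⊎ (Σ[ Z ∈ Fm ] Sr G (Y ⋁ Z)) ⊎ (Σ[ Z ∈ Fm ] Sr G (Z ⋁ Y))

  Disjunct? : ∀ Y → Dec (Disjunct Y)
  Disjunct? Y = Antecedent? Y ⊎-dec (∃? (λ Z → Sr? (Y ⋁ Z)) (Sr⇒∈universe ∘ sr-∨₂)
                               ⊎-dec ∃? (λ Z → Sr? (Z ⋁ Y)) (Sr⇒∈universe ∘ sr-∨₁))

  Compatible : List Prem → Set
  Compatible js = ∀ {i j} → i ∈ js → j ∈ js → pΣ i ⊆ (pΣ j ++ pΘ j)

  module _ (js : List Prem) where
    open Join G js

    Compatible⇒indexed : Compatible js → ∀ (i j : Fin (length js)) → i ≢ j →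
                          pΣ (lookup js i) ⊆ (pΣ (lookup js j) ++ pΘ (lookup js j))
    Compatible⇒indexed compat i j _ = compat (∈-lookup i) (∈-lookup j)

    indexed⇒Compatible : (∀ (i j : Fin (length js)) → i ≢ j →
                            pΣ (lookup js i) ⊆ (pΣ (lookup js j) ++ pΘ (lookup js j))) → Compatible js
    indexed⇒Compatible compat {i} {j} i∈ j∈ with Any.index i∈ Fin.≟ Any.index j∈
    ... | yes same = subst (λ k → pΣ i ⊆ (pΣ k ++ pΘ k)) i≡j ∈-++⁺ˡ
      where
        i≡j : i ≡ j
        i≡j = trans (lookup-index i∈) (trans (cong (lookup js) same) (sym (lookup-index j∈)))
    ... | no differ = subst₂ (λ k l → pΣ k ⊆ (pΣ l ++ pΘ l)) (sym (lookup-index i∈)) (sym (lookup-index j∈))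
                        (compat _ _ differ)

    Compatible? : Dec (Compatible js)
    Compatible? = map′ fromAll toAll (All.all? (λ i → All.all? (λ j → pΣ i ⊆? (pΣ j ++ pΘ j)) js) js)
      where
        AllPairs : Set
        AllPairs = All (λ i → All (λ j → pΣ i ⊆ (pΣ j ++ pΘ j)) js) js
        fromAll : AllPairs → Compatible js
        fromAll a i∈ j∈ = All.lookup (All.lookup a i∈) j∈
        toAll : Compatible js → AllPairs
        toAll compat = All.tabulate λ i∈ → All.tabulate λ j∈ → compat i∈ j∈

    Υ? : ∀ Y → Dec (Υ Y)
    Υ? Y = Any.any? (λ j → pA j ≟ Y) js

    ∀Υ? : ∀ {H : Fm → Set} → (∀ Y → Dec (H Y)) → Dec (∀ Y → Υ Y → H Y)
    ∀Υ? {H} H? = map′ fromAll toAll (All.all? (H? ∘ pA) js)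
      where
        fromAll : All (H ∘ pA) js → ∀ Y → Υ Y → H Y
        fromAll a Y u with find u
        ... | j , j∈ , refl = All.lookup a j∈
        toAll : (∀ Y → Υ Y → H Y) → All (H ∘ pA) js
        toAll f = All.tabulate λ {j} j∈ → f (pA j) (lose j∈ refl)

    ΥImp : Fm → Set
    ΥImp x = Σ[ Y ∈ Fm ] Σ[ Z ∈ Fm ] (x ≡ (Y ⊃ Z) × Υ Y)

    ΥImp? : ∀ x → Dec (ΥImp x)
    ΥImp? (Y ⊃ Z) = map′ (λ u → Y , Z , refl , u) (λ { (_ , _ , refl , u) → u }) (Υ? Y)
    ΥImp? (var _) = no λ { (_ , _ , () , _) }
    ΥImp? falsum = no λ { (_ , _ , () , _) }
    ΥImp? (_ ⋀ _) = no λ { (_ , _ , () , _) }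
    ΥImp? (_ ⋁ _) = no λ { (_ , _ , () , _) }

    ΣAt? : ∀ x → Dec (ΣAt x)
    ΣAt? x = IsVar? x ×-dec Any.any? (λ j → x ∈? pΣ j) js

    ΣImp? : ∀ x → Dec (ΣImp x)
    ΣImp? x = IsImp? x ×-dec Any.any? (λ j → x ∈? pΣ j) js

    ΘAt? : ∀ x → Dec (ΘAt x)
    ΘAt? x = IsVar? x ×-dec All.all? (λ j → x ∈? pΘ j) js

    ΘImp? : ∀ x → Dec (ΘImp x)
    ΘImp? x = ΥImp? x ×-dec All.all? (λ j → x ∈? pΘ j) js

    ΣImp⊆ΥImp? : Dec (∀ Y Z → ΣImp (Y ⊃ Z) → Υ Y)
    ΣImp⊆ΥImp? = map′ fromAll toAll (All.all? (λ j → All.all? Guarded? (pΣ j)) js)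
      where
        Guarded : Fm → Set
        Guarded x = IsImp x → ΥImp x
        Guarded? : ∀ x → Dec (Guarded x)
        Guarded? x with IsImp? x
        ... | yes imp = map′ const (λ g → g imp) (ΥImp? x)
        ... | no ¬imp = yes (⊥-elim ∘ ¬imp)
        fromAll : All (All Guarded ∘ pΣ) js → ∀ Y Z → ΣImp (Y ⊃ Z) → Υ Y
        fromAll a Y Z (imp , u) with find u
        ... | j , j∈ , x∈ with All.lookup (All.lookup a j∈) x∈ imp
        ... | _ , _ , refl , υ = υ
        toAll : (∀ Y Z → ΣImp (Y ⊃ Z) → Υ Y) → All (All Guarded ∘ pΣ) js
        toAll f = All.tabulate λ j∈ →
          All.tabulate λ { {Y ⊃ Z} x∈ imp → Y , Z , refl , f Y Z (imp , lose j∈ x∈) }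

    Cond? : Dec Cond
    Cond? = (0 ℕ.<? length js) ×-dec (map′ Compatible⇒indexed indexed⇒Compatible Compatible? ×-dec ΣImp⊆ΥImp?)

    PremisesWF : Set
    PremisesWF = All (λ j → ⊆Γbar (pΣ j) × ⊆Γbar (pΘ j)) js

    PremisesWF? : Dec PremisesWF
    PremisesWF? = All.all? (λ j → ⊆Γbar? (pΣ j) ×-dec ⊆Γbar? (pΘ j)) js

    OrContext : Fm → Set
    OrContext x = ΣAt x ⊎ ΘAt x ⊎ ΣImp x ⊎ ΘImp x

    OrContext? : ∀ x → Dec (OrContext x)
    OrContext? x = ΣAt? x ⊎-dec ΘAt? x ⊎-dec ΣImp? x ⊎-dec ΘImp? x

    AtContext : Fm → Fm → Set
    AtContext F x = ΣAt x ⊎ (ΘAt x × x ≢ F) ⊎ ΣImp x ⊎ ΘImp x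

    AtContext? : ∀ F x → Dec (AtContext F x)
    AtContext? F x = ΣAt? x ⊎-dec (ΘAt? x ×-dec ¬? (x ≟ F)) ⊎-dec ΣImp? x ⊎-dec ΘImp? x

    AtContext⇒OrContext : ∀ {F x} → AtContext F x → OrContext x
    AtContext⇒OrContext = Sum.map₂ (Sum.map₁ proj₁)

    OrContext⇒Γbar : 0 < length js → PremisesWF → ∀ {x} → OrContext x → Γbar G x
    OrContext⇒Γbar nonempty wf =
      [ inΣ ∘ proj₂ , [ inΘ nonempty wf ∘ proj₂ , [ inΣ ∘ proj₂ , inΘ nonempty wf ∘ proj₂ ]′ ]′ ]′
      where
        inΣ : ∀ {x} → Any (λ j → x ∈ pΣ j) js → Γbar G x
        inΣ u = let (j , j∈ , x∈) = find u in proj₁ (All.lookup wf j∈) _ x∈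
        inΘ : ∀ {ks} → 0 < length ks → All (λ j → ⊆Γbar (pΣ j) × ⊆Γbar (pΘ j)) ks →
              ∀ {x} → All (λ j → x ∈ pΘ j) ks → Γbar G x
        inΘ _ ((_ , θ) ∷ _) (x∈ ∷ _) = θ _ x∈

    AtContext⇒Γbar : 0 < length js → PremisesWF → ∀ {F x} → AtContext F x → Γbar G x
    AtContext⇒Γbar nonempty wf = OrContext⇒Γbar nonempty wf ∘ AtContext⇒OrContext

    ⋈At-instances : Fm → Applications (map toIrr js)
    ⋈At-instances F =
      applyIf (Cond? ×-dec (PremisesWF? ×-dec (VBot? F ×-dec (¬? (ΣAt? F) ×-dec (∀Υ? Antecedent? ×-dec Sr? F)))))
        (reg (setOf (AtContext? F)) F)
        (λ (cond , wf , v , F∉Σ , ante , sr) →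
          (setOf-⊆Γbar (AtContext? F) (AtContext⇒Γbar (proj₁ cond) wf) , sr) ,
          ⋈At cond (setOf-≈ₚ (AtContext? F) (AtContext⇒Γbar (proj₁ cond) wf)) v F∉Σ ante)

    ⋈∨-instances : Fm → Fm → Applications (map toIrr js)
    ⋈∨-instances C₁ C₂ =
      applyIf (Cond? ×-dec (PremisesWF? ×-dec (Υ? C₁ ×-dec (Υ? C₂ ×-dec
               (∀Υ? Disjunct? ×-dec Sr? (C₁ ⋁ C₂))))))
        (reg (setOf OrContext?) (C₁ ⋁ C₂))
        (λ (cond , wf , υ₁ , υ₂ , disj , sr) →
          (setOf-⊆Γbar OrContext? (OrContext⇒Γbar (proj₁ cond) wf) , sr) ,
          ⋈∨ cond (setOf-≈ₚ OrContext? (OrContext⇒Γbar (proj₁ cond) wf)) υ₁ υ₂ disj)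

    joinInstances : Applications (map toIrr js)
    joinInstances =
      concatMap ⋈At-instances universe ++ concatMap (λ C₁ → concatMap (⋈∨-instances C₁) universe) universe

  module JoinTransfer (js ks : List Prem)
    (up : ∀ {j} → j ∈ js → Σ[ k ∈ Prem ] (k ∈ ks × toIrr j ⊑ toIrr k))
    (down : ∀ {k} → k ∈ ks → Σ[ j ∈ Prem ] (j ∈ js × toIrr j ⊑ toIrr k)) where

    private
      module J = Join G js
      module K = Join G ks

    Υ⇒ : ∀ {Y} → J.Υ Y → K.Υ Y
    Υ⇒ u with find u
    ... | j , j∈ , refl with up j∈
    ... | k , k∈ , (_ , A≡ , _) = lose k∈ (sym A≡)

    Υ⇐ : ∀ {Y} → K.Υ Y → J.Υ Y
    Υ⇐ u with find u
    ... | k , k∈ , refl with down k∈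
    ... | j , j∈ , (_ , A≡ , _) = lose j∈ A≡

    Σ⇒ : ∀ {x} → Any (λ j → x ∈ pΣ j) js → Any (λ k → x ∈ pΣ k) ks
    Σ⇒ u with find u
    ... | j , j∈ , x∈ with up j∈
    ... | k , k∈ , (Σ≐ , _ , _) = lose k∈ (proj₁ Σ≐ x∈)

    Σ⇐ : ∀ {x} → Any (λ k → x ∈ pΣ k) ks → Any (λ j → x ∈ pΣ j) js
    Σ⇐ u with find u
    ... | k , k∈ , x∈ with down k∈
    ... | j , j∈ , (Σ≐ , _ , _) = lose j∈ (proj₂ Σ≐ x∈)

    Θ⇒ : ∀ {x} → All (λ j → x ∈ pΘ j) js → All (λ k → x ∈ pΘ k) ks
    Θ⇒ a = All.tabulate λ k∈ → let (j , j∈ , (_ , _ , Θ⊆)) = down k∈ in Θ⊆ (All.lookup a j∈)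

    Cond⇒ : J.Cond → K.Cond
    Cond⇒ (nonempty , compat , guarded) =
      nonempty⇒ nonempty , Compatible⇒indexed ks compat′ , λ Y Z (imp , u) → Υ⇒ (guarded Y Z (imp , Σ⇐ u))
      where
        nonempty⇒ : 0 < length js → 0 < length ks
        nonempty⇒ n = let (j , j∈) = nonempty⇒∃∈ n ; (k , k∈ , _) = up j∈ in ∈-length k∈
        compat′ : Compatible ks
        compat′ k∈ k′∈ x∈ with down k∈ | down k′∈
        ... | j , j∈ , (Σ≐ , _ , _) | j′ , j′∈ , (Σ≐′ , _ , Θ⊆′) =
          ++-⊆ (proj₁ Σ≐′) Θ⊆′ (indexed⇒Compatible js compat j∈ j′∈ (proj₂ Σ≐ x∈))

    OrContext⇒ : ∀ {x} → OrContext js x → OrContext ks x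
    OrContext⇒ (inj₁ (v , u)) = inj₁ (v , Σ⇒ u)
    OrContext⇒ (inj₂ (inj₁ (v , a))) = inj₂ (inj₁ (v , Θ⇒ a))
    OrContext⇒ (inj₂ (inj₂ (inj₁ (imp , u)))) = inj₂ (inj₂ (inj₁ (imp , Σ⇒ u)))
    OrContext⇒ (inj₂ (inj₂ (inj₂ ((Y , Z , x≡ , υ) , a)))) =
      inj₂ (inj₂ (inj₂ ((Y , Z , x≡ , Υ⇒ υ) , Θ⇒ a)))

    AtContext⇒ : ∀ {F x} → AtContext js F x → AtContext ks F x
    AtContext⇒ (inj₁ (v , u)) = inj₁ (v , Σ⇒ u)
    AtContext⇒ (inj₂ (inj₁ ((v , a) , x≢F))) = inj₂ (inj₁ ((v , Θ⇒ a) , x≢F))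
    AtContext⇒ (inj₂ (inj₂ (inj₁ (imp , u)))) = inj₂ (inj₂ (inj₁ (imp , Σ⇒ u)))
    AtContext⇒ (inj₂ (inj₂ (inj₂ ((Y , Z , x≡ , υ) , a)))) =
      inj₂ (inj₂ (inj₂ ((Y , Z , x≡ , Υ⇒ υ) , Θ⇒ a)))

    ⋈At-covered : ∀ {Γ F} → Sr G F → PremisesWF ks → J.Cond → Γ ≈ₚ AtContext js F → VBot F →
                  ¬ J.ΣAt F → (∀ Y → J.Υ Y → Antecedent Y) → Covers (joinInstances ks) (reg Γ F)
    ⋈At-covered {Γ} {F} sr wf cond Γ≈ v F∉Σ ante =
      ++⁺ˡ (Any-concatMap⁺ (⋈At-instances ks) (Sr⇒∈universe sr)
        (applyIf-covers _ _ _ (Cond⇒ cond , wf , v , F∉Σ ∘ Product.map₂ Σ⇐ , (λ Y → ante Y ∘ Υ⇐) , sr)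
          (reg-⊑ Γ⊆)))
      where
        Γ⊆ : Γ ⊆ setOf (AtContext? ks F)
        Γ⊆ = ⊆setOf (AtContext? ks F) (AtContext⇒Γbar ks (proj₁ (Cond⇒ cond)) wf)
                    (λ {x} → AtContext⇒ ∘ proj₁ (Γ≈ x))

    ⋈∨-covered : ∀ {Γ C₁ C₂} → Sr G (C₁ ⋁ C₂) → PremisesWF ks → J.Cond → Γ ≈ₚ OrContext js →
                 J.Υ C₁ → J.Υ C₂ → (∀ Y → J.Υ Y → Disjunct Y) →
                 Covers (joinInstances ks) (reg Γ (C₁ ⋁ C₂))
    ⋈∨-covered {Γ} {C₁} {C₂} sr wf cond Γ≈ υ₁ υ₂ disj =
      ++⁺ʳ (concatMap (⋈At-instances ks) universe)
        (Any-concatMap⁺ (λ C → concatMap (⋈∨-instances ks C) universe) (Sr⇒∈universe (sr-∨₁ sr))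
          (Any-concatMap⁺ (⋈∨-instances ks C₁) (Sr⇒∈universe (sr-∨₂ sr))
            (applyIf-covers _ _ _ (Cond⇒ cond , wf , Υ⇒ υ₁ , Υ⇒ υ₂ , (λ Y → disj Y ∘ Υ⇐) , sr)
              (reg-⊑ Γ⊆))))
      where
        Γ⊆ : Γ ⊆ setOf (OrContext? ks)
        Γ⊆ = ⊆setOf (OrContext? ks) (OrContext⇒Γbar ks (proj₁ (Cond⇒ cond)) wf)
                    (λ {x} → OrContext⇒ ∘ proj₁ (Γ≈ x))

  Batch : Set
  Batch = Σ (List Seq) Applications

  unaryBatch : Seq → Batch
  unaryBatch p = p ∷ [] , unaryInstances p

  binaryBatch : Seq → Seq → Batch
  binaryBatch p q = p ∷ q ∷ [] , binaryInstances p q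

  joinBatch : List Prem → Batch
  joinBatch ks = map toIrr ks , joinInstances ks

  batches : List Seq → List Batch
  batches L =
    ([] , nullaryInstances) ∷ map unaryBatch L ++ cartesianProductWith binaryBatch L L ++
    map joinBatch (sublists (irregulars L))

  batches-premises : ∀ L → All (λ b → All (_∈ L) (proj₁ b)) (batches L)
  batches-premises L =
    [] ∷ All.++⁺ (All.map⁺ (All.tabulate (_∷ [])))
         (All.++⁺ (All.cartesianProductWith⁺ (PropEq.setoid Seq) (PropEq.setoid Seq) binaryBatch L L
                     (λ p∈ q∈ → p∈ ∷ q∈ ∷ []))
                  (All.map⁺ (All.tabulate λ ks∈ →
                    All.map⁺ (All.tabulate (∈-irregulars⁻ L ∘ ∈-sublists⇒⊆ (irregulars L) ks∈)))))

  CoveredOver : List Seq → Seq → Set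
  CoveredOver L σ = Any (λ b → Covers (proj₂ b) σ) (batches L)

  unary-CoveredOver : ∀ {L p σ} → p ∈ L → Covers (unaryInstances p) σ → CoveredOver L σ
  unary-CoveredOver p∈ c = there (++⁺ˡ (map⁺ (lose p∈ c)))

  binary-CoveredOver : ∀ {L p q σ} → p ∈ L → q ∈ L → Covers (binaryInstances p q) σ → CoveredOver L σ
  binary-CoveredOver {L} p∈ q∈ c =
    there (++⁺ʳ (map unaryBatch L) (++⁺ˡ (lose (∈-cartesianProductWith⁺ binaryBatch p∈ q∈) c)))

  join-CoveredOver : ∀ {L ks σ} → ks ∈ sublists (irregulars L) → Covers (joinInstances ks) σ → CoveredOver L σ
  join-CoveredOver {L} ks∈ c =
    there (++⁺ʳ (map unaryBatch L) (++⁺ʳ (cartesianProductWith binaryBatch L L) (map⁺ (lose ks∈ c))))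

  -- The database premises subsuming the premises of a join instance.
  module Selection (L : List Seq) (wfL : All (WF G) L) (js : List Prem)
                   (subsumed : All (Subsumed L) (map toIrr js)) where

    Selected : Prem → Set
    Selected k = Any (λ j → toIrr j ⊑ toIrr k) js

    Selected? : ∀ k → Dec (Selected k)
    Selected? k = Any.any? (λ j → toIrr j ⊑? toIrr k) js

    ks : List Prem
    ks = filter Selected? (irregulars L)

    ks∈ : ks ∈ sublists (irregulars L)
    ks∈ = filter∈sublists Selected? (irregulars L)

    up : ∀ {j} → j ∈ js → Σ[ k ∈ Prem ] (k ∈ ks × toIrr j ⊑ toIrr k)
    up j∈ with find (All.lookup subsumed (∈-map⁺ toIrr j∈))
    ... | irr Σ Θ C , p∈ , j⊑ = (Σ , Θ , C) , ∈-filter⁺ _ (∈-irregulars⁺ p∈) (lose j∈ j⊑) , j⊑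
    ... | reg _ _ , _ , ()

    down : ∀ {k} → k ∈ ks → Σ[ j ∈ Prem ] (j ∈ js × toIrr j ⊑ toIrr k)
    down k∈ = find (proj₂ (∈-filter⁻ Selected? {xs = irregulars L} k∈))

    wf : PremisesWF ks
    wf = All.tabulate λ k∈ →
      let (σ , θ , _) = All.lookup wfL (∈-irregulars⁻ L (proj₁ (∈-filter⁻ Selected? {xs = irregulars L} k∈))) in
      σ , θ

    open JoinTransfer js ks up down public

  step-CoveredOver : ∀ {L ps σ} → All (WF G) L → Step G ps σ → All (Subsumed L) ps → CoveredOver L σ
  step-CoveredOver wfL (w , ax-reg v Γ≈) [] = here (ax-reg-covered w v Γ≈)
  step-CoveredOver wfL (w , ax-irr v Θ≈) [] = here (ax-irr-covered w v Θ≈)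
  step-CoveredOver wfL ((_ , sr) , ∧-reg k Γ≐) (p⊑ ∷ []) =
    let (_ , q∈ , Γ⊆) = reg-subsumer p⊑ in
    unary-CoveredOver q∈ (∧-reg-covered sr (proj₁ (All.lookup wfL q∈)) k Γ≐ Γ⊆)
  step-CoveredOver wfL ((_ , _ , sr) , ∧-irr k Σ≐ Θ≐) (p⊑ ∷ []) =
    let (_ , _ , q∈ , Σ≐′ , Θ⊆) = irr-subsumer p⊑ ; (σ , θ , _) = All.lookup wfL q∈ in
    unary-CoveredOver q∈ (∧-irr-covered sr σ θ k Σ≐ Θ≐ Σ≐′ Θ⊆)
  step-CoveredOver wfL ((_ , _ , sr) , ∨-irr Σ≈ Θ≈ c₁ c₂) (p⊑ ∷ q⊑ ∷ []) =
    let (_ , _ , p∈ , Σ₁≐ , Θ₁⊆) = irr-subsumer p⊑ ; (_ , _ , q∈ , Σ₂≐ , Θ₂⊆) = irr-subsumer q⊑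
        (σ₁ , θ₁ , _) = All.lookup wfL p∈ ; (σ₂ , _ , _) = All.lookup wfL q∈ in
    binary-CoveredOver p∈ q∈ (∨-covered sr σ₁ θ₁ σ₂ Σ≈ Θ≈ c₁ c₂ Σ₁≐ Θ₁⊆ Σ₂≐ Θ₂⊆)
  step-CoveredOver wfL ((_ , sr) , ⊃∈-reg Γ≐ c) (p⊑ ∷ []) =
    let (_ , q∈ , Γ⊆) = reg-subsumer p⊑ in
    unary-CoveredOver q∈ (⊃∈-reg-covered sr (proj₁ (All.lookup wfL q∈)) Γ≐ c Γ⊆)
  step-CoveredOver wfL ((_ , _ , sr) , ⊃∈-irr Λ Θ≐ Σ≐ disjoint c min) (p⊑ ∷ []) =
    let (_ , _ , q∈ , Σ≐′ , Θ⊆) = irr-subsumer p⊑ ; (σ , θ , _) = All.lookup wfL q∈ in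
    unary-CoveredOver q∈ (⊃∈-irr-covered Λ sr σ θ Θ≐ Σ≐ disjoint c min Σ≐′ Θ⊆)
  step-CoveredOver wfL ((_ , _ , sr) , ⊃∉ adm c ¬c _) (p⊑ ∷ []) =
    let (_ , q∈ , Γ⊆) = reg-subsumer p⊑ in
    unary-CoveredOver q∈ (⊃∉-covered sr adm c ¬c Γ⊆)
  step-CoveredOver {L} wfL ((_ , sr) , ⋈At {js} cond Γ≈ v F∉Σ ante) subsumed =
    join-CoveredOver {L} ks∈ (⋈At-covered sr wf cond Γ≈ v F∉Σ ante)
    where open Selection L wfL js subsumed
  step-CoveredOver {L} wfL ((_ , sr) , ⋈∨ {js} cond Γ≈ υ₁ υ₂ disj) subsumed =
    join-CoveredOver {L} ks∈ (⋈∨-covered sr wf cond Γ≈ υ₁ υ₂ disj)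
    where open Selection L wfL js subsumed

  record Application (L : List Seq) : Set where
    constructor application
    field
      premises : List Seq
      premises∈ : All (_∈ L) premises
      conclusion : Seq
      step : Step G premises conclusion

  open Application public

  toApplication : ∀ {L ps} → All (_∈ L) ps → Σ Seq (Step G ps) → Application L
  toApplication ∈L (σ , st) = application _ ∈L σ st

  batchApplications : ∀ {L} → ∃ (λ b → All (_∈ L) (proj₁ b)) → List (Application L)
  batchApplications ((ps , as) , ∈L) = map (toApplication ∈L) as

  batchApplications-covers : ∀ {L σ} (b : ∃ (λ b → All (_∈ L) (proj₁ b))) → Covers (proj₂ (proj₁ b)) σ →
                             Any (λ a → σ ⊑ conclusion a) (batchApplications b)
  batchApplications-covers ((ps , as) , ∈L) = map⁺

  applications : ∀ L → List (Application L)
  applications L = concatMap batchApplications (All.toList (batches-premises L))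

  applications-complete : ∀ {L ps σ} → All (WF G) L → Step G ps σ → All (Subsumed L) ps →
                          Any (λ a → σ ⊑ conclusion a) (applications L)
  applications-complete {L} wfL st subsumed =
    concat⁺ (map⁺ (Any.map (λ {b} → batchApplications-covers b)
      (Any-toList⁺ (batches-premises L) (step-CoveredOver wfL st subsumed))))

  -- The search loop

  canonical : Seq → Seq
  canonical (reg Γ C) = reg (universe ∩ Γ) C
  canonical (irr Σ Θ C) = irr (universe ∩ Σ) (universe ∩ Θ) C

  canonical-⊑ : ∀ {σ} → WF G σ → canonical σ ⊑ σ
  canonical-⊑ {reg _ _} (γ , _) = reg-⊑ (proj₁ (universe∩-≐ γ))
  canonical-⊑ {irr _ _ _} (σ , θ , _) = irr-⊑ (universe∩-≐ σ) (proj₁ (universe∩-≐ θ))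

  ⊑-canonical : ∀ {σ} → WF G σ → σ ⊑ canonical σ
  ⊑-canonical {reg _ _} (γ , _) = reg-⊑ (proj₂ (universe∩-≐ γ))
  ⊑-canonical {irr _ _ _} (σ , θ , _) = irr-⊑ (≐-sym (universe∩-≐ σ)) (proj₂ (universe∩-≐ θ))

  irrOf : List Fm × List Fm → Fm → Seq
  irrOf (Σ , Θ) C = irr Σ Θ C

  canonicals : List Seq
  canonicals =
    cartesianProductWith reg (sublists universe) universe ++
    cartesianProductWith irrOf (cartesianProduct (sublists universe) (sublists universe)) universe

  canonical∈canonicals : ∀ {σ} → WF G σ → canonical σ ∈ canonicals
  canonical∈canonicals {reg Γ C} (_ , sr) =
    ∈-++⁺ˡ (∈-cartesianProductWith⁺ reg (filter∈sublists (_∈? Γ) universe) (Sr⇒∈universe sr))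
  canonical∈canonicals {irr Σ Θ C} (_ , _ , sr) =
    ∈-++⁺ʳ (cartesianProductWith reg (sublists universe) universe)
      (∈-cartesianProductWith⁺ irrOf
        (∈-cartesianProduct⁺ (filter∈sublists (_∈? Σ) universe) (filter∈sublists (_∈? Θ) universe))
        (Sr⇒∈universe sr))

  coverage : List Seq → ℕ
  coverage L = count (λ s → Any.any? (s ⊑?_) L) canonicals

  coverage-grows : ∀ {L L′ σ} → L ⊆ L′ → WF G σ → Subsumed L′ σ → ¬ Subsumed L σ →
                   suc (coverage L) ≤ coverage L′
  coverage-grows {L} {L′} L⊆L′ w σ⊑L′ σ⋢L =
    count-mono-< (λ s → Any.any? (s ⊑?_) L) (λ s → Any.any? (s ⊑?_) L′) (Any-resp-⊆ L⊆L′) canonicals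
      (canonical∈canonicals w) (Any.map (⊑-trans (canonical-⊑ w)) σ⊑L′)
      (σ⋢L ∘ Any.map (⊑-trans (⊑-canonical w)))

  DB-sound : ∀ n {σ} → DB G n σ → WF G σ × Deriv G σ
  DB-sound (suc n) (inj₁ d) = DB-sound n d
  DB-sound (suc zero) (inj₂ st) = proj₁ st , by st []
  DB-sound (suc (suc n)) (inj₂ (_ , st , ds , _)) = proj₁ st , by st (All.map (proj₂ ∘ DB-sound (suc n)) ds)

  record Snapshot (n : ℕ) : Set where
    field
      entries : List Seq
      entries∈DB : All (DB G n) entries
      DB⊑entries : ∀ {σ} → DB G n σ → Subsumed entries σ

    entries-WF : All (WF G) entries
    entries-WF = All.map (proj₁ ∘ DB-sound n) entries∈DB

  open Snapshot

  initial : Snapshot 1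
  initial = record
    { entries = map conclusion (applications [])
    ; entries∈DB = All.map⁺ (All.tabulate λ {a} _ → axiom a)
    ; DB⊑entries = λ { (inj₂ st) → map⁺ (applications-complete [] st []) }
    }
    where
      axiom : (a : Application []) → DB G 1 (conclusion a)
      axiom (application [] [] _ st) = inj₂ st
      axiom (application (_ ∷ _) (() ∷ _) _ _)

  module Round {k} (S : Snapshot (suc k)) where

    New : Set
    New = Σ Seq (I G (suc k))

    keepNew : Application (entries S) → List New
    keepNew (application ps ∈L σ st) with Any.any? (σ ⊑?_) (entries S)
    ... | yes _ = []
    ... | no new = (σ , ps , st , All.map (All.lookup (entries∈DB S)) ∈L , old) ∷ []
      where
        old : ¬ (Σ[ τ ∈ Seq ] (DB G (suc k) τ × σ ⊑ τ))
        old (τ , τ∈ , σ⊑τ) = new (Any.map (⊑-trans σ⊑τ) (DB⊑entries S τ∈))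

    fresh : List New
    fresh = concatMap keepNew (applications (entries S))

    keepNew-spec : ∀ a → Subsumed (entries S) (conclusion a) ⊎ Any (λ n → conclusion a ⊑ proj₁ n) (keepNew a)
    keepNew-spec (application ps ∈L σ st) with Any.any? (σ ⊑?_) (entries S)
    ... | yes σ⊑ = inj₁ σ⊑
    ... | no _ = inj₂ (here ⊑-refl)

    subsumed-or-fresh : ∀ {σ} → Any (λ a → σ ⊑ conclusion a) (applications (entries S)) →
                        Subsumed (entries S) σ ⊎ Any (λ n → σ ⊑ proj₁ n) fresh
    subsumed-or-fresh c =
      let (a , a∈ , σ⊑a) = find c in
      Sum.map (Any.map (⊑-trans σ⊑a)) (Any-concatMap⁺ keepNew a∈ ∘ Any.map (⊑-trans σ⊑a)) (keepNew-spec a)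

    I⇒unsubsumed : ∀ {σ} → I G (suc k) σ → ¬ Subsumed (entries S) σ
    I⇒unsubsumed (_ , _ , _ , old) c =
      let (τ , τ∈ , σ⊑τ) = find c in old (τ , All.lookup (entries∈DB S) τ∈ , σ⊑τ)

    fresh-complete : ∀ {σ} → I G (suc k) σ → Any (λ n → σ ⊑ proj₁ n) fresh
    fresh-complete i@(_ , st , ds , _) =
      [ ⊥-elim ∘ I⇒unsubsumed i , id ]′
        (subsumed-or-fresh (applications-complete (entries-WF S) st (All.map (DB⊑entries S) ds)))

    next : Snapshot (suc (suc k))
    next = record
      { entries = entries S ++ map proj₁ fresh
      ; entries∈DB = All.++⁺ (All.map inj₁ (entries∈DB S)) (All.map⁺ (All.tabulate λ {n} _ → inj₂ (proj₂ n)))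
      ; DB⊑entries = λ { (inj₁ d) → ++⁺ˡ (DB⊑entries S d)
                       ; (inj₂ i) → ++⁺ʳ (entries S) (map⁺ (fresh-complete i)) }
      }

    none-fresh : fresh ≡ [] → ∀ {σ} → ¬ Any (λ n → σ ⊑ proj₁ n) fresh
    none-fresh empty c = ¬Any[] (subst (Any _) empty c)

    exhausted : fresh ≡ [] → ∀ σ → ¬ I G (suc k) σ
    exhausted empty σ = none-fresh empty ∘ fresh-complete

    module _ (empty : fresh ≡ []) where
      mutual
        derivable⇒subsumed : ∀ {σ} → Deriv G σ → Subsumed (entries S) σ
        derivable⇒subsumed (by st ds) =
          [ id , ⊥-elim ∘ none-fresh empty ]′
            (subsumed-or-fresh (applications-complete (entries-WF S) st (all-subsumed ds)))

        all-subsumed : ∀ {ps} → All (Deriv G) ps → All (Subsumed (entries S)) ps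
        all-subsumed [] = []
        all-subsumed (d ∷ ds) = derivable⇒subsumed d ∷ all-subsumed ds

      saturated : Saturated G (DB G (suc k))
      saturated σ d =
        let (τ , τ∈ , σ⊑τ) = find (derivable⇒subsumed d) in τ , All.lookup (entries∈DB S) τ∈ , σ⊑τ

    fresh-grows : ∀ {n} → n ∈ fresh → suc (coverage (entries S)) ≤ coverage (entries next)
    fresh-grows {σ , i} n∈ =
      coverage-grows (xs⊆xs++ys (entries S) _) (proj₁ (proj₁ (proj₂ i)))
        (++⁺ʳ (entries S) (map⁺ (lose n∈ ⊑-refl))) (I⇒unsubsumed i)

  snapshot : ∀ k → Snapshot (suc k)
  snapshot zero = initial
  snapshot (suc k) = Round.next (snapshot k)

  GoalSequent : Seq → Set
  GoalSequent (reg _ C) = C ≡ G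
  GoalSequent (irr _ _ _) = ⊥

  GoalSequent? : ∀ σ → Dec (GoalSequent σ)
  GoalSequent? (reg _ C) = C ≟ G
  GoalSequent? (irr _ _ _) = no id

  goal-entry⇒DB : ∀ {n} (S : Snapshot n) → Any GoalSequent (entries S) → Σ[ Γ ∈ List Fm ] DB G n (reg Γ G)
  goal-entry⇒DB S g with find g
  ... | reg Γ _ , σ∈ , refl = Γ , All.lookup (entries∈DB S) σ∈

  DB⇒goal-entry : ∀ {n Γ} (S : Snapshot n) → DB G n (reg Γ G) → Any GoalSequent (entries S)
  DB⇒goal-entry S d = Any.map (λ { {reg _ _} (refl , _) → refl }) (DB⊑entries S d)

  Outcome : ℕ → Set
  Outcome n = (Σ[ Γ ∈ List Fm ] (DB G n (reg Γ G) × Deriv G (reg Γ G)))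
            ⊎ ((∀ Γ → ¬ DB G n (reg Γ G)) × Database G (DB G n) × Saturated G (DB G n))

  Halts : Set
  Halts = Σ[ n ∈ ℕ ] ((∀ m → m < n → ¬ Stop G m) × Stop G n × Outcome n)

  ¬Stop-below : ∀ {k} → (∀ j → j < k → ¬ Stop G j) → ¬ Stop G k → ∀ j → j < suc k → ¬ Stop G j
  ¬Stop-below earlier now j j< with ℕ.m<1+n⇒m<n∨m≡n j<
  ... | inj₁ j<k = earlier j j<k
  ... | inj₂ refl = now

  -- fuel bounds the number of rounds left: each round adds a canonical sequent to the coverage
  mutual
    run : ∀ fuel k → length canonicals < coverage (entries (snapshot k)) + fuel →
          (∀ j → j < suc k → ¬ Stop G j) → Halts
    run zero k bound _ =
      ⊥-elim (ℕ.<⇒≱ bound (ℕ.≤-trans (ℕ.≤-reflexive (ℕ.+-identityʳ _)) (count≤length _ canonicals)))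
    run (suc fuel) k bound earlier with Any.any? GoalSequent? (entries (snapshot k))
    ... | yes g = let (Γ , d) = goal-entry⇒DB (snapshot k) g in
                  suc k , earlier , inj₂ (Γ , d) , inj₁ (Γ , d , proj₂ (DB-sound (suc k) d))
    -- fresh is inspected through an equation: a with-abstraction over it would normalise the instance lists
    ... | no ¬g = continue fuel k bound earlier ¬g (Round.fresh (snapshot k)) refl

    continue : ∀ fuel k → length canonicals < coverage (entries (snapshot k)) + suc fuel →
               (∀ j → j < suc k → ¬ Stop G j) → ¬ Any GoalSequent (entries (snapshot k)) →
               ∀ ns → Round.fresh (snapshot k) ≡ ns → Halts
    continue fuel k bound earlier ¬g [] empty =
      suc k , earlier , inj₁ (exhausted empty) ,
      inj₂ ((λ Γ → ¬g ∘ DB⇒goal-entry (snapshot k)) , (λ σ → DB-sound (suc k)) , saturated empty)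
      where open Round (snapshot k)
    continue fuel k bound earlier ¬g (n ∷ _) nonempty = run fuel (suc k) bound′ (¬Stop-below earlier continues)
      where
        open Round (snapshot k)
        bound′ : length canonicals < coverage (entries (snapshot (suc k))) + fuel
        bound′ = ℕ.<-≤-trans bound (ℕ.≤-trans (ℕ.≤-reflexive (ℕ.+-suc _ fuel))
                   (ℕ.+-monoˡ-≤ fuel (fresh-grows (subst (n ∈_) (sym nonempty) (here refl)))))
        continues : ¬ Stop G (suc k)
        continues = [ (λ none → none (proj₁ n) (proj₂ n)) , (λ (Γ , d) → ¬g (DB⇒goal-entry (snapshot k) d)) ]′

  rightAtom : ∀ {A} → Sr G A → Σ[ F ∈ Fm ] (VBot F × Sr G F)
  rightAtom {var n} sr = var n , inj₁ (isVar n) , sr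
  rightAtom {falsum} sr = falsum , inj₂ refl , sr
  rightAtom {A ⋀ B} sr = rightAtom (sr-∧₁ sr)
  rightAtom {A ⋁ B} sr = rightAtom (sr-∨₁ sr)
  rightAtom {A ⊃ B} sr = rightAtom (sr-⊃ sr)

  ¬Stop₀ : ¬ Stop G 0
  ¬Stop₀ (inj₁ none) =
    let (F , v , sr) = rightAtom sr-top in
    none (reg (setOf (AxiomAtom? F)) F)
         ((setOf-⊆Γbar (AxiomAtom? F) (AxiomAtom⇒Γbar F) , sr) ,
          ax-reg v (setOf-≈ₚ (AxiomAtom? F) (AxiomAtom⇒Γbar F)))
  ¬Stop₀ (inj₂ (_ , ()))

theorem4p2 : (G : Fm) →
    Σ[ n ∈ ℕ ]
      ((∀ m → m < n → ¬ Stop G m) × Stop G n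
       × ((Σ[ Γ ∈ List Fm ] (DB G n (reg Γ G) × Deriv G (reg Γ G)))
          ⊎ ((∀ Γ → ¬ DB G n (reg Γ G)) × Database G (DB G n) × Saturated G (DB G n))))
theorem4p2 G = run (suc (length canonicals)) 0 (ℕ.m≤n+m _ _) (¬Stop-below (λ _ ()) ¬Stop₀)
  where open FSearch G
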